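{- For every integer $n\ge 3$, \[ \frac{2}{9}(n-3)^2 \le H_{\mathrm{s}}(n,3) \le \frac14 n^2. \]
   Context: A pure simplicial complex of dimension $d-1$ on $[n]=\{1,\dots,n\}$ is a nonempty family $C$ of $d$-element subsets of $[n]$ (facets). Its adjacency graph has the facets as vertices, with $X,Y$ adjacent when $|X\setminus Y|=1$. $C$ is strongly connected if this graph is connected, and its diameter is the diameter of this graph. $H_{\mathrm{s}}(n,d)$ denotes the maximum diameter of strongly connected pure $(d-1)$-dimensional complexes on $[n]$; so $H_{\mathrm{s}}(n,3)$ concerns families of $3$-subsets of $[n]$. -}

module Defs where

open import Data.Nat using (ℕ; zero; suc; _+_; _≤_; _<_)
open import Data.Fin using (Fin)
open import Data.Fin.Subset using (Subset; _─_; ∣_∣)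
open import Data.List using (List; [])
open import Data.List.Membership.Propositional using (_∈_)
open import Data.List.Relation.Unary.All using (All)
open import Data.Product using (Σ; _×_; ∃)
open import Relation.Binary.PropositionalEquality using (_≡_; _≢_)

-- Pure (d-1)-dimensional simplicial complex on [n]:
-- a nonempty family of d-element subsets of [n].
record IsPure (n d : ℕ) (C : List (Subset n)) : Set where
  field
    nonempty : C ≢ []
    uniform  : All (λ X → ∣ X ∣ ≡ d) C

Adjacent : ∀ {n} → Subset n → Subset n → Set
Adjacent X Y = ∣ X ─ Y ∣ ≡ 1

data Walk {n : ℕ} (C : List (Subset n)) : Subset n → Subset n → ℕ → Set where
  here : ∀ {X} → X ∈ C → Walk C X X 0
  step : ∀ {X Y Z k} → X ∈ C → Adjacent X Y → Walk C Y Z k → Walk C X Z (suc k)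

StronglyConnected : ∀ {n} → List (Subset n) → Set
StronglyConnected C = ∀ {X Y} → X ∈ C → Y ∈ C → ∃ λ k → Walk C X Y k

DiamAtMost : ∀ {n} → List (Subset n) → ℕ → Set
DiamAtMost C m = ∀ {X Y} → X ∈ C → Y ∈ C → Σ ℕ λ k → k ≤ m × Walk C X Y k

DiamAtLeast : ∀ {n} → List (Subset n) → ℕ → Set
DiamAtLeast C m = Σ _ λ X → Σ _ λ Y → X ∈ C × Y ∈ C ×
                  (∀ k → Walk C X Y k → m ≤ k)

HsAtLeast : ℕ → ℕ → ℕ → Set
HsAtLeast n d m = Σ (List (Subset n)) λ C →
  IsPure n d C × StronglyConnected C × DiamAtLeast C m

HsAtMost : ℕ → ℕ → ℕ → Set
HsAtMost n d m = ∀ (C : List (Subset n)) →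
  IsPure n d C → StronglyConnected C → DiamAtMost C m

-- Both bounds are about induced paths F₀, …, F_L of the facet graph: consecutive facets are
-- adjacent, facets two or more steps apart share at most one vertex.
--
-- Upper bound. Any walk can be shortened to an induced path with the same ends. Along an induced
-- path each facet after the first brings at least four ordered pairs of vertices not contained in
-- an earlier facet, so 6 + 4L ≤ n², and any two facets are joined by a walk of length ≤ n²/4.
--
-- Lower bound. The facets of an induced path form a strongly connected complex of diameter L.
-- For n ≈ 3k we take Walecki's decomposition of the complete graph on 2k + 1 base vertices into
-- zigzag paths, cone the j-th path from a new apex a_j, and join consecutive fans through one of
-- two extra vertices. A "clock" assigning to each pair of vertices the index of the (at most two,
-- consecutive) facets containing it shows that the resulting sequence of about 2k² facets is an
-- induced path; this gives (2/9)(n − 3)². The cases n ≤ 8 are checked by computation.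

module Submission where

open import Defs
open import Data.Bool using (true; false; if_then_else_; _∧_)
open import Data.Fin using (Fin; zero; suc; toℕ; fromℕ<)
open import Data.Fin.Properties using (toℕ-injective; toℕ-fromℕ<)
open import Data.Fin.Subset using (Subset; Nonempty; _∈_; _∉_; _∩_; _∪_; _─_; _-_; ∣_∣; ⁅_⁆; ⊥)
open import Data.Fin.Subset.Properties
  using ( ∩-comm; ∩-idem; ∩-zeroˡ; ∩-zeroʳ; ∩-distribˡ-∪; ∪-identityˡ; p─⊥≡p; ∣⊥∣≡0; ∣p∣≤n; ∣p∩q∣≤∣q∣; ∉⊥
        ; x∈p∧x∉q⇒x∈p─q; x≢y⇒x∉⁅y⁆; x∉⁅y⁆⇒x≢y; x∈p∪q⁻; x∈p∪q⁺; x∈p∩q⁻; x∈p∩q⁺ )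
open import Data.List using (List; applyUpTo)
open import Data.List.Membership.Propositional using () renaming (_∈_ to _∈ᴸ_)
open import Data.List.Membership.Propositional.Properties using (∈-applyUpTo⁺; ∈-applyUpTo⁻)
import Data.List.Relation.Unary.All as All
open import Data.Nat using (ℕ; zero; suc; _+_; _*_; _∸_; _⊓_; _≤_; _<_; z≤n; s≤s; s≤s⁻¹; z<s; _≟_; _≤?_; _<?_; ⌊_/2⌋; parity; NonZero)
open import Data.Nat.Properties
open import Algebra.Properties.CommutativeMonoid.Sum +-0-commutativeMonoid using (sum; sum-cong-≗; ∑-distrib-+)
open import Data.Nat.DivMod
  using ( _/_; _%_; m≡m%n+[m/n]*n; m%n<n; m%n%n≡m%n; n%n≡0; [m+n]%n≡m%n; [m+kn]%n≡m%n; m<n⇒m%n≡m; %-distribˡ-+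
        ; m*n/n≡m; m/n*n≤m; m<n⇒m/n≡0; /-mono-≤; +-distrib-/-∣ˡ )
open import Data.Nat.Divisibility using (divides-refl)
open import Data.Nat.Tactic.RingSolver using (solve-∀)
open import Data.Parity.Base using (Parity; 0ℙ; 1ℙ)
open import Data.Parity.Properties using () renaming (_≟_ to _≟ℙ_)
open import Data.Product using (_×_; _,_; Σ; ∃; ∃₂; Σ-syntax; proj₁; proj₂)
open import Data.Sum using (_⊎_; inj₁; inj₂)
open import Data.Unit using (⊤; tt)
open import Data.Vec using ([]; _∷_; here; there; lookup)
open import Data.Vec.Properties using (lookup-zipWith; lookup⇒[]=)
open import Function using (_∘_)
open import Relation.Binary.PropositionalEquality
open import Relation.Nullary using (¬_; Dec; yes; no; does; contradiction; ¬?)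
open import Relation.Nullary.Decidable using (map′; dec-true; dec-false; decidable-stable; True; toWitness; _×-dec_; _→-dec_)
open import Relation.Unary using (Decidable)

private variable
  n L a b c : ℕ
  x y : Fin n
  p q X Y : Subset n

-- Subsets and facets of size three

∣p∣≡∣p∩q∣+∣p─q∣ : (p q : Subset n) → ∣ p ∣ ≡ ∣ p ∩ q ∣ + ∣ p ─ q ∣
∣p∣≡∣p∩q∣+∣p─q∣ []          []          = refl
∣p∣≡∣p∩q∣+∣p─q∣ (true ∷ p)  (true ∷ q)  = cong suc (∣p∣≡∣p∩q∣+∣p─q∣ p q)
∣p∣≡∣p∩q∣+∣p─q∣ (true ∷ p)  (false ∷ q) = trans (cong suc (∣p∣≡∣p∩q∣+∣p─q∣ p q)) (sym (+-suc _ _))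
∣p∣≡∣p∩q∣+∣p─q∣ (false ∷ p) (true ∷ q)  = ∣p∣≡∣p∩q∣+∣p─q∣ p q
∣p∣≡∣p∩q∣+∣p─q∣ (false ∷ p) (false ∷ q) = ∣p∣≡∣p∩q∣+∣p─q∣ p q

∣p─q∣≡∣q─p∣ : ∣ p ∣ ≡ ∣ q ∣ → ∣ p ─ q ∣ ≡ ∣ q ─ p ∣
∣p─q∣≡∣q─p∣ {p = p} {q} eq = +-cancelˡ-≡ ∣ p ∩ q ∣ _ _ (begin
  ∣ p ∩ q ∣ + ∣ p ─ q ∣ ≡⟨ ∣p∣≡∣p∩q∣+∣p─q∣ p q ⟨
  ∣ p ∣                 ≡⟨ eq ⟩
  ∣ q ∣                 ≡⟨ ∣p∣≡∣p∩q∣+∣p─q∣ q p ⟩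
  ∣ q ∩ p ∣ + ∣ q ─ p ∣ ≡⟨ cong (λ r → ∣ r ∣ + ∣ q ─ p ∣) (∩-comm q p) ⟩
  ∣ p ∩ q ∣ + ∣ q ─ p ∣ ∎)
  where open ≡-Reasoning

∣p∣≡∣q∣∧∣p─q∣≡0⇒p≡q : ∣ p ∣ ≡ ∣ q ∣ → ∣ p ─ q ∣ ≡ 0 → p ≡ q
∣p∣≡∣q∣∧∣p─q∣≡0⇒p≡q {p = []}        {[]}        _  _  = refl
∣p∣≡∣q∣∧∣p─q∣≡0⇒p≡q {p = true ∷ p}  {true ∷ q}  eq e = cong (true ∷_) (∣p∣≡∣q∣∧∣p─q∣≡0⇒p≡q (suc-injective eq) e)
∣p∣≡∣q∣∧∣p─q∣≡0⇒p≡q {p = false ∷ p} {false ∷ q} eq e = cong (false ∷_) (∣p∣≡∣q∣∧∣p─q∣≡0⇒p≡q eq e)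
∣p∣≡∣q∣∧∣p─q∣≡0⇒p≡q {p = false ∷ p} {true ∷ q}  eq e = contradiction (subst (_≤ ∣ q ∣) eq ∣p∣≤∣q∣) (<-irrefl refl)
  where
  ∣p∣≤∣q∣ : ∣ p ∣ ≤ ∣ q ∣
  ∣p∣≤∣q∣ = begin
    ∣ p ∣                 ≡⟨ ∣p∣≡∣p∩q∣+∣p─q∣ p q ⟩
    ∣ p ∩ q ∣ + ∣ p ─ q ∣ ≡⟨ cong (∣ p ∩ q ∣ +_) e ⟩
    ∣ p ∩ q ∣ + 0         ≡⟨ +-identityʳ _ ⟩
    ∣ p ∩ q ∣             ≤⟨ ∣p∩q∣≤∣q∣ p q ⟩
    ∣ q ∣                 ∎
    where open ≤-Reasoning

x∈p─q⁻ : ∀ (p q : Subset n) → x ∈ p ─ q → x ∈ p × x ∉ q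
x∈p─q⁻ (true ∷ p) (false ∷ q) here        = here , λ ()
x∈p─q⁻ {x = zero} (_ ∷ p)     (true ∷ q)  ()
x∈p─q⁻ {x = zero} (false ∷ p) (false ∷ q) ()
x∈p─q⁻ (_ ∷ p)    (_ ∷ q)     (there x∈)  with x∈p─q⁻ p q x∈
... | x∈p , x∉q = there x∈p , λ { (there x∈q) → x∉q x∈q }

∣p-x∣ : ∀ (p : Subset n) → x ∈ p → suc ∣ p - x ∣ ≡ ∣ p ∣
∣p-x∣ (true ∷ p)  here        = cong (λ r → suc ∣ r ∣) (p─⊥≡p p)
∣p-x∣ (true ∷ p)  (there x∈p) = cong suc (∣p-x∣ p x∈p)
∣p-x∣ (false ∷ p) (there x∈p) = ∣p-x∣ p x∈p

∣p∣>0⇒nonempty : 0 < ∣ p ∣ → Nonempty p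
∣p∣>0⇒nonempty {p = true ∷ p}  _ = zero , here
∣p∣>0⇒nonempty {p = false ∷ p} h with ∣p∣>0⇒nonempty h
... | x , x∈p = suc x , there x∈p

x∈p⇒0<∣p∣ : x ∈ p → 0 < ∣ p ∣
x∈p⇒0<∣p∣ {p = p} x∈p = subst (0 <_) (∣p-x∣ p x∈p) z<s

distinct⇒2≤∣p∣ : x ≢ y → x ∈ p → y ∈ p → 2 ≤ ∣ p ∣
distinct⇒2≤∣p∣ {x = x} {y} {p} x≢y x∈p y∈p =
  subst (2 ≤_) (∣p-x∣ p x∈p) (s≤s (x∈p⇒0<∣p∣ y∈p-x))
  where
  y∈p-x : y ∈ p - x
  y∈p-x = x∈p∧x∉q⇒x∈p─q y∈p (x≢y⇒x∉⁅y⁆ (λ y≡x → x≢y (sym y≡x)))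

2≤∣p∣⇒distinct : 2 ≤ ∣ p ∣ → ∃₂ λ x y → x ≢ y × x ∈ p × y ∈ p
2≤∣p∣⇒distinct {p = p} 2≤∣p∣ with ∣p∣>0⇒nonempty {p = p} (≤-trans (s≤s z≤n) 2≤∣p∣)
... | x , x∈p with ∣p∣>0⇒nonempty {p = p - x} (s≤s⁻¹ (subst (2 ≤_) (sym (∣p-x∣ p x∈p)) 2≤∣p∣))
...   | y , y∈p-x with x∈p─q⁻ p ⁅ x ⁆ y∈p-x
...     | y∈p , y∉⁅x⁆ = x , y , (λ x≡y → x∉⁅y⁆⇒x≢y y∉⁅x⁆ (sym x≡y)) , x∈p , y∈p

-- For facets of size 3, being apart means being neither equal nor adjacent.
record Apart (X Y : Subset n) : Set where
  constructor ∣∩∣≤1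
  field ∣X∩Y∣≤1 : ∣ X ∩ Y ∣ ≤ 1

apart? : (X Y : Subset n) → Dec (Apart X Y)
apart? X Y = map′ ∣∩∣≤1 Apart.∣X∩Y∣≤1 (∣ X ∩ Y ∣ ≤? 1)

module _ {X Y : Subset n} (∣X∣≡3 : ∣ X ∣ ≡ 3) where

  ∣X∩Y∣+∣X─Y∣≡3 : ∣ X ∩ Y ∣ + ∣ X ─ Y ∣ ≡ 3
  ∣X∩Y∣+∣X─Y∣≡3 = trans (sym (∣p∣≡∣p∩q∣+∣p─q∣ X Y)) ∣X∣≡3

  adjacent⇒∣X∩Y∣≡2 : Adjacent X Y → ∣ X ∩ Y ∣ ≡ 2
  adjacent⇒∣X∩Y∣≡2 adj = +-cancelʳ-≡ 1 _ 2 (trans (cong (∣ X ∩ Y ∣ +_) (sym adj)) ∣X∩Y∣+∣X─Y∣≡3)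

  adjacent⇒¬apart : Adjacent X Y → ¬ Apart X Y
  adjacent⇒¬apart adj (∣∩∣≤1 h) = <⇒≱ (s≤s (s≤s z≤n)) (subst (_≤ 1) (adjacent⇒∣X∩Y∣≡2 adj) h)

  ¬apart⇒≡⊎adjacent : ∣ Y ∣ ≡ 3 → ¬ Apart X Y → X ≡ Y ⊎ Adjacent X Y
  ¬apart⇒≡⊎adjacent ∣Y∣≡3 ¬apart with ∣ X ─ Y ∣ in eq
  ... | 0           = inj₁ (∣p∣≡∣q∣∧∣p─q∣≡0⇒p≡q (trans ∣X∣≡3 (sym ∣Y∣≡3)) eq)
  ... | 1           = inj₂ refl
  ... | suc (suc d) = contradiction (subst (4 ≤_) ∣X∩Y∣+∣X─Y∣≡3 four≤) (<⇒≱ (n<1+n 3))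
    where
    four≤ : 4 ≤ ∣ X ∩ Y ∣ + ∣ X ─ Y ∣
    four≤ = +-mono-≤ (≰⇒> (¬apart ∘ ∣∩∣≤1)) (subst (2 ≤_) (sym eq) (s≤s (s≤s z≤n)))

  shared-pair⇒adjacent : x ≢ y → x ∈ X ∩ Y → y ∈ X ∩ Y → {z : Fin n} → z ∈ X → z ∉ Y → Adjacent X Y
  shared-pair⇒adjacent x≢y x∈ y∈ {z} z∈X z∉Y = ≤-antisym ∣X─Y∣≤1 (x∈p⇒0<∣p∣ (x∈p∧x∉q⇒x∈p─q z∈X z∉Y))
    where
    ∣X─Y∣≤1 : ∣ X ─ Y ∣ ≤ 1
    ∣X─Y∣≤1 = +-cancelˡ-≤ 2 _ _ (begin
      2 + ∣ X ─ Y ∣         ≤⟨ +-monoˡ-≤ _ (distinct⇒2≤∣p∣ x≢y x∈ y∈) ⟩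
      ∣ X ∩ Y ∣ + ∣ X ─ Y ∣ ≡⟨ ∣X∩Y∣+∣X─Y∣≡3 ⟩
      3                     ∎)
      where open ≤-Reasoning

¬adjacent-self : ∣ X ∣ ≡ 3 → ¬ Adjacent X X
¬adjacent-self {X = X} ∣X∣≡3 adj =
  contradiction (trans (sym ∣X∣≡3) (trans (cong ∣_∣ (sym (∩-idem X))) (adjacent⇒∣X∩Y∣≡2 {X = X} {Y = X} ∣X∣≡3 adj))) λ ()

¬apart-self : ∣ X ∣ ≡ 3 → ¬ Apart X X
¬apart-self {X = X} ∣X∣≡3 (∣∩∣≤1 h) = <⇒≱ (s≤s (s≤s z≤n)) (subst (_≤ 1) (trans (cong ∣_∣ (∩-idem X)) ∣X∣≡3) h)

adjacent-sym : ∣ X ∣ ≡ ∣ Y ∣ → Adjacent X Y → Adjacent Y X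
adjacent-sym {X = X} {Y} ∣X∣≡∣Y∣ adj = trans (sym (∣p─q∣≡∣q─p∣ {p = X} {Y} ∣X∣≡∣Y∣)) adj

apart-sym : Apart X Y → Apart Y X
apart-sym {X = X} {Y} (∣∩∣≤1 h) = ∣∩∣≤1 (subst (λ Z → ∣ Z ∣ ≤ 1) (∩-comm X Y) h)

-- Counting ordered pairs

∣p∪q∣+∣p∩q∣≡∣p∣+∣q∣ : (p q : Subset n) → ∣ p ∪ q ∣ + ∣ p ∩ q ∣ ≡ ∣ p ∣ + ∣ q ∣
∣p∪q∣+∣p∩q∣≡∣p∣+∣q∣ []          []          = refl
∣p∪q∣+∣p∩q∣≡∣p∣+∣q∣ (true ∷ p)  (true ∷ q)  =
  cong suc (trans (+-suc _ _) (trans (cong suc (∣p∪q∣+∣p∩q∣≡∣p∣+∣q∣ p q)) (sym (+-suc ∣ p ∣ ∣ q ∣))))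
∣p∪q∣+∣p∩q∣≡∣p∣+∣q∣ (true ∷ p)  (false ∷ q) = cong suc (∣p∪q∣+∣p∩q∣≡∣p∣+∣q∣ p q)
∣p∪q∣+∣p∩q∣≡∣p∣+∣q∣ (false ∷ p) (true ∷ q)  = trans (cong suc (∣p∪q∣+∣p∩q∣≡∣p∣+∣q∣ p q)) (sym (+-suc ∣ p ∣ ∣ q ∣))
∣p∪q∣+∣p∩q∣≡∣p∣+∣q∣ (false ∷ p) (false ∷ q) = ∣p∪q∣+∣p∩q∣≡∣p∣+∣q∣ p q

[p─r]∩[q─r]≡[p∩q]─r : (p q r : Subset n) → (p ─ r) ∩ (q ─ r) ≡ (p ∩ q) ─ r
[p─r]∩[q─r]≡[p∩q]─r []      []      []          = refl
[p─r]∩[q─r]≡[p∩q]─r (x ∷ p) (y ∷ q) (true ∷ r)  = cong (false ∷_) ([p─r]∩[q─r]≡[p∩q]─r p q r)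
[p─r]∩[q─r]≡[p∩q]─r (x ∷ p) (y ∷ q) (false ∷ r) = cong (_ ∷_) ([p─r]∩[q─r]≡[p∩q]─r p q r)

∣p∪q∣≤∣p∣+∣q∣ : (p q : Subset n) → ∣ p ∪ q ∣ ≤ ∣ p ∣ + ∣ q ∣
∣p∪q∣≤∣p∣+∣q∣ p q = ≤-trans (m≤m+n ∣ p ∪ q ∣ ∣ p ∩ q ∣) (≤-reflexive (∣p∪q∣+∣p∩q∣≡∣p∣+∣q∣ p q))

sum-mono-≤ : {f g : Fin n → ℕ} → (∀ a → f a ≤ g a) → sum f ≤ sum g
sum-mono-≤ {zero}  _ = z≤n
sum-mono-≤ {suc n} f≤g = +-mono-≤ (f≤g zero) (sum-mono-≤ (λ a → f≤g (suc a)))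

sum-indicator : (Z : Subset n) (c : ℕ) → sum (λ a → if lookup Z a then c else 0) ≡ ∣ Z ∣ * c
sum-indicator []          c = refl
sum-indicator (true ∷ Z)  c = cong (c +_) (sum-indicator Z c)
sum-indicator (false ∷ Z) c = sum-indicator Z c

-- A set of ordered pairs of elements of Fin n, given by its rows.
Arcs : ℕ → Set
Arcs n = Fin n → Subset n

infixr 7 _∩ᵃ_
infixr 6 _∪ᵃ_

_∪ᵃ_ _∩ᵃ_ : Arcs n → Arcs n → Arcs n
(R ∪ᵃ S) a = R a ∪ S a
(R ∩ᵃ S) a = R a ∩ S a

∥_∥ : Arcs n → ℕ
∥ R ∥ = sum (λ a → ∣ R a ∣)

arcs : Subset n → Arcs n
arcs X a = if lookup X a then X - a else ⊥

∥R∪S∥+∥R∩S∥≡∥R∥+∥S∥ : (R S : Arcs n) → ∥ R ∪ᵃ S ∥ + ∥ R ∩ᵃ S ∥ ≡ ∥ R ∥ + ∥ S ∥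
∥R∪S∥+∥R∩S∥≡∥R∥+∥S∥ R S = begin
  ∥ R ∪ᵃ S ∥ + ∥ R ∩ᵃ S ∥                   ≡⟨ ∑-distrib-+ (λ a → ∣ R a ∪ S a ∣) (λ a → ∣ R a ∩ S a ∣) ⟨
  sum (λ a → ∣ R a ∪ S a ∣ + ∣ R a ∩ S a ∣) ≡⟨ sum-cong-≗ (λ a → ∣p∪q∣+∣p∩q∣≡∣p∣+∣q∣ (R a) (S a)) ⟩
  sum (λ a → ∣ R a ∣ + ∣ S a ∣)             ≡⟨ ∑-distrib-+ (λ a → ∣ R a ∣) (λ a → ∣ S a ∣) ⟩
  ∥ R ∥ + ∥ S ∥                             ∎
  where open ≡-Reasoning

∥R∩[S∪T]∥≤∥R∩S∥+∥R∩T∥ : (R S T : Arcs n) → ∥ R ∩ᵃ (S ∪ᵃ T) ∥ ≤ ∥ R ∩ᵃ S ∥ + ∥ R ∩ᵃ T ∥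
∥R∩[S∪T]∥≤∥R∩S∥+∥R∩T∥ R S T = begin
  ∥ R ∩ᵃ (S ∪ᵃ T) ∥                           ≤⟨ sum-mono-≤ row≤ ⟩
  sum (λ a → ∣ R a ∩ S a ∣ + ∣ R a ∩ T a ∣)   ≡⟨ ∑-distrib-+ (λ a → ∣ R a ∩ S a ∣) (λ a → ∣ R a ∩ T a ∣) ⟩
  ∥ R ∩ᵃ S ∥ + ∥ R ∩ᵃ T ∥                     ∎
  where
  open ≤-Reasoning
  row≤ : ∀ a → ∣ R a ∩ (S a ∪ T a) ∣ ≤ ∣ R a ∩ S a ∣ + ∣ R a ∩ T a ∣
  row≤ a = subst (λ r → ∣ r ∣ ≤ ∣ R a ∩ S a ∣ + ∣ R a ∩ T a ∣) (sym (∩-distribˡ-∪ (R a) (S a) (T a)))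
                 (∣p∪q∣≤∣p∣+∣q∣ (R a ∩ S a) (R a ∩ T a))

∥R∥≤n*n : (R : Arcs n) → ∥ R ∥ ≤ n * n
∥R∥≤n*n {n} R = ≤-trans (sum-mono-≤ (λ a → ∣p∣≤n (R a))) (≤-reflexive (sum-const n))
  where
  sum-const : ∀ m → sum {m} (λ _ → n) ≡ m * n
  sum-const zero    = refl
  sum-const (suc m) = cong (n +_) (sum-const m)

∥arcs∥ : (Z : Subset n) → ∥ arcs Z ∥ ≡ ∣ Z ∣ * (∣ Z ∣ ∸ 1)
∥arcs∥ {n} Z = trans (sum-cong-≗ row) (sum-indicator Z (∣ Z ∣ ∸ 1))
  where
  row : ∀ a → ∣ arcs Z a ∣ ≡ (if lookup Z a then ∣ Z ∣ ∸ 1 else 0)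
  row a with lookup Z a in eq
  ... | true  = cong (_∸ 1) (∣p-x∣ Z (lookup⇒[]= a Z eq))
  ... | false = ∣⊥∣≡0 n

arcs-∩ : (X Y : Subset n) (a : Fin n) → arcs X a ∩ arcs Y a ≡ arcs (X ∩ Y) a
arcs-∩ X Y a rewrite lookup-zipWith _∧_ a X Y with lookup X a | lookup Y a
... | true  | true  = [p─r]∩[q─r]≡[p∩q]─r X Y ⁅ a ⁆
... | true  | false = ∩-zeroʳ (X - a)
... | false | _     = ∩-zeroˡ _

∥arcs∩arcs∥ : (X Y : Subset n) → ∥ arcs X ∩ᵃ arcs Y ∥ ≡ ∣ X ∩ Y ∣ * (∣ X ∩ Y ∣ ∸ 1)
∥arcs∩arcs∥ X Y = trans (sum-cong-≗ (λ a → cong ∣_∣ (arcs-∩ X Y a))) (∥arcs∥ (X ∩ Y))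

∥arcs∩arcs∥-apart : {Y : Subset n} → Apart X Y → ∥ arcs X ∩ᵃ arcs Y ∥ ≡ 0
∥arcs∩arcs∥-apart {X = X} {Y} (∣∩∣≤1 h) with ∣ X ∩ Y ∣ | ∥arcs∩arcs∥ X Y
... | 0 | eq = eq
... | 1 | eq = eq
... | suc (suc _) | _ = contradiction h λ { (s≤s ()) }

∥arcs∩arcs∥-adjacent : {Y : Subset n} → ∣ X ∣ ≡ 3 → Adjacent X Y → ∥ arcs X ∩ᵃ arcs Y ∥ ≡ 2
∥arcs∩arcs∥-adjacent {X = X} {Y} ∣X∣≡3 adj =
  trans (∥arcs∩arcs∥ X Y) (cong (λ c → c * (c ∸ 1)) (adjacent⇒∣X∩Y∣≡2 {X = X} {Y} ∣X∣≡3 adj))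

-- Induced paths

record IsInducedPath (F : ℕ → Subset n) (L : ℕ) : Set where
  field
    size     : ∀ {i} → i ≤ L → ∣ F i ∣ ≡ 3
    adjacent : ∀ {i} → i < L → Adjacent (F i) (F (suc i))
    apart    : ∀ {i j} → 2 + i ≤ j → j ≤ L → Apart (F i) (F j)

open IsInducedPath

-- Each facet after the first contributes at least four ordered pairs not seen before.
induced-path-length : {F : ℕ → Subset n} → IsInducedPath F L → 6 + 4 * L ≤ n * n
induced-path-length {n} {L} {F} path = ≤-trans (grow L ≤-refl) (∥R∥≤n*n (seen L))
  where
  seen : ℕ → Arcs n
  seen zero    = arcs (F 0)
  seen (suc i) = arcs (F (suc i)) ∪ᵃ seen i

  ∥arcs∥≡6 : ∀ {i} → i ≤ L → ∥ arcs (F i) ∥ ≡ 6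
  ∥arcs∥≡6 {i} i≤L = trans (∥arcs∥ (F i)) (cong (λ c → c * (c ∸ 1)) (size path i≤L))

  disjoint : ∀ {j} i → 2 + i ≤ j → j ≤ L → ∥ arcs (F j) ∩ᵃ seen i ∥ ≡ 0
  disjoint zero    i<j j≤L = ∥arcs∩arcs∥-apart (apart-sym (apart path i<j j≤L))
  disjoint {j} (suc i) i<j j≤L = n≤0⇒n≡0 (begin
    ∥ arcs (F j) ∩ᵃ (arcs (F (suc i)) ∪ᵃ seen i) ∥                   ≤⟨ ∥R∩[S∪T]∥≤∥R∩S∥+∥R∩T∥ (arcs (F j)) _ _ ⟩
    ∥ arcs (F j) ∩ᵃ arcs (F (suc i)) ∥ + ∥ arcs (F j) ∩ᵃ seen i ∥   ≡⟨ cong₂ _+_ (∥arcs∩arcs∥-apart (apart-sym (apart path i<j j≤L)))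
                                                                                   (disjoint i (<⇒≤ i<j) j≤L) ⟩
    0                                                                 ∎)
    where open ≤-Reasoning

  backward : ∀ {i} → suc i ≤ L → Adjacent (F (suc i)) (F i)
  backward {i} i<L = adjacent-sym {X = F i} {F (suc i)} (trans (size path (<⇒≤ i<L)) (sym (size path i<L))) (adjacent path i<L)

  common : ∀ i → suc i ≤ L → ∥ arcs (F (suc i)) ∩ᵃ seen i ∥ ≤ 2
  common zero    i<L = ≤-reflexive (∥arcs∩arcs∥-adjacent {X = F 1} {F 0} (size path i<L) (backward i<L))
  common (suc i) i<L = begin
    ∥ arcs (F (2 + i)) ∩ᵃ (arcs (F (suc i)) ∪ᵃ seen i) ∥                     ≤⟨ ∥R∩[S∪T]∥≤∥R∩S∥+∥R∩T∥ (arcs (F (2 + i))) _ _ ⟩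
    ∥ arcs (F (2 + i)) ∩ᵃ arcs (F (suc i)) ∥ + ∥ arcs (F (2 + i)) ∩ᵃ seen i ∥ ≡⟨ cong₂ _+_ (∥arcs∩arcs∥-adjacent {X = F (2 + i)} {F (suc i)} (size path i<L) (backward i<L))
                                                                                             (disjoint i ≤-refl i<L) ⟩
    2 + 0                                                                     ∎
    where open ≤-Reasoning

  grow : ∀ i → i ≤ L → 6 + 4 * i ≤ ∥ seen i ∥
  grow zero    _   = ≤-reflexive (sym (∥arcs∥≡6 z≤n))
  grow (suc i) i<L = +-cancelʳ-≤ 2 _ _ (begin
    (6 + 4 * suc i) + 2                               ≡⟨ cong (λ m → 6 + m + 2) (*-suc 4 i) ⟩
    (6 + (4 + 4 * i)) + 2                             ≡⟨ shuffle (4 * i) ⟩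
    6 + (6 + 4 * i)                                   ≤⟨ +-monoʳ-≤ 6 (grow i (<⇒≤ i<L)) ⟩
    6 + ∥ seen i ∥                                    ≡⟨ cong (_+ ∥ seen i ∥) (∥arcs∥≡6 i<L) ⟨
    ∥ arcs (F (suc i)) ∥ + ∥ seen i ∥                 ≡⟨ ∥R∪S∥+∥R∩S∥≡∥R∥+∥S∥ (arcs (F (suc i))) (seen i) ⟨
    ∥ seen (suc i) ∥ + ∥ arcs (F (suc i)) ∩ᵃ seen i ∥ ≤⟨ +-monoʳ-≤ ∥ seen (suc i) ∥ (common i i<L) ⟩
    ∥ seen (suc i) ∥ + 2                              ∎)
    where
    open ≤-Reasoning
    shuffle : ∀ m → 6 + (4 + m) + 2 ≡ 6 + (6 + m)
    shuffle = solve-∀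

_◂_ : {A : Set} → A → (ℕ → A) → ℕ → A
(x ◂ f) zero    = x
(x ◂ f) (suc i) = f i

induced-cong : {F G : ℕ → Subset n} → F ≗ G → IsInducedPath F L → IsInducedPath G L
induced-cong F≗G path = record
  { size     = λ i≤L → subst (λ X → ∣ X ∣ ≡ 3) (F≗G _) (size path i≤L)
  ; adjacent = λ i<L → subst₂ Adjacent (F≗G _) (F≗G _) (adjacent path i<L)
  ; apart    = λ i<j j≤L → subst₂ Apart (F≗G _) (F≗G _) (apart path i<j j≤L)
  }

induced-suffix : {F : ℕ → Subset n} (i : ℕ) → i ≤ L → IsInducedPath F L → IsInducedPath (λ t → F (i + t)) (L ∸ i)
induced-suffix {L = L} {F} i i≤L path = record
  { size     = λ t≤ → size path (shift t≤)
  ; adjacent = λ {t} t< → subst (λ s → Adjacent (F (i + t)) (F s)) (sym (+-suc i t))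
                                 (adjacent path (subst (_≤ L) (+-suc i t) (shift t<)))
  ; apart    = λ {s} {t} s<t t≤ → apart path (subst (_≤ i + t) (+-suc² s) (+-monoʳ-≤ i s<t)) (shift t≤)
  }
  where
  +-suc² : ∀ s → i + (2 + s) ≡ 2 + (i + s)
  +-suc² s = trans (+-suc i (suc s)) (cong suc (+-suc i s))
  shift : ∀ {t} → t ≤ L ∸ i → i + t ≤ L
  shift {t} t≤ = ≤-trans (+-monoʳ-≤ i t≤) (≤-reflexive (m+[n∸m]≡n i≤L))

induced-cons : {F : ℕ → Subset n} → ∣ X ∣ ≡ 3 → Adjacent X (F 0) →
               (∀ {t} → 1 ≤ t → t ≤ L → Apart X (F t)) → IsInducedPath F L → IsInducedPath (X ◂ F) (suc L)
induced-cons {X = X} {F = F} ∣X∣≡3 adj far path = record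
  { size     = λ { {zero} _ → ∣X∣≡3 ; {suc i} (s≤s i≤L) → size path i≤L }
  ; adjacent = λ { {zero} _ → adj ; {suc i} (s≤s i<L) → adjacent path i<L }
  ; apart    = λ { {zero} {suc j} (s≤s 1≤j) (s≤s j≤L) → far 1≤j j≤L
                 ; {suc i} {suc j} (s≤s i<j) (s≤s j≤L) → apart path i<j j≤L }
  }

induced-single : ∣ X ∣ ≡ 3 → IsInducedPath (λ _ → X) 0
induced-single ∣X∣≡3 = record
  { size     = λ _ → ∣X∣≡3
  ; adjacent = λ ()
  ; apart    = λ { (s≤s (s≤s _)) () }
  }

induced-path? : (F : ℕ → Subset n) (L : ℕ) → Dec (IsInducedPath F L)
induced-path? F L = map′ to from (allUpTo? (λ i → ∣ F i ∣ ≟ 3) (suc L)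
                           ×-dec allUpTo? (λ i → ∣ F i ─ F (suc i) ∣ ≟ 1) L
                           ×-dec allUpTo? (λ j → allUpTo? (λ i → (2 + i ≤? j) →-dec apart? (F i) (F j)) j) (suc L))
  where
  Checks : Set
  Checks = (∀ {i} → i < suc L → ∣ F i ∣ ≡ 3)
         × (∀ {i} → i < L → Adjacent (F i) (F (suc i)))
         × (∀ {j} → j < suc L → ∀ {i} → i < j → 2 + i ≤ j → Apart (F i) (F j))
  to : Checks → IsInducedPath F L
  to (sizes , adjacents , aparts) = record
    { size     = λ i≤L → sizes (s≤s i≤L)
    ; adjacent = adjacents
    ; apart    = λ 2+i≤j j≤L → aparts (s≤s j≤L) (≤-trans (n≤1+n _) 2+i≤j) 2+i≤j
    }
  from : IsInducedPath F L → Checks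
  from path = (λ i<1+L → size path (s≤s⁻¹ i<1+L))
            , adjacent path
            , λ j<1+L _ 2+i≤j → apart path 2+i≤j (s≤s⁻¹ j<1+L)

-- Upper bound: walks contain induced paths

last-≤ : {P : ℕ → Set} → Decidable P → P 0 → ∀ k → ∃ λ i → i ≤ k × P i × (∀ {j} → i < j → j ≤ k → ¬ P j)
last-≤ P? p0 zero = 0 , z≤n , p0 , λ 0<j j≤0 → contradiction (≤-trans 0<j j≤0) λ ()
last-≤ P? p0 (suc k) with P? (suc k)
... | yes p = suc k , ≤-refl , p , λ k<j j≤k → contradiction (≤-trans k<j j≤k) (<-irrefl refl)
... | no ¬p with last-≤ P? p0 k
...   | i , i≤k , pi , later = i , m≤n⇒m≤1+n i≤k , pi , later′
  where
  later′ : ∀ {j} → i < j → j ≤ suc k → ¬ _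
  later′ {j} i<j j≤1+k with m≤n⇒m<n∨m≡n j≤1+k
  ... | inj₁ j<1+k = later i<j (s≤s⁻¹ j<1+k)
  ... | inj₂ refl  = ¬p

module _ {n : ℕ} {C : List (Subset n)} where

  private variable
    Z : Subset n
    i k : ℕ

  vertex : Walk C X Z k → ℕ → Subset n
  vertex (here {X} _)     = λ _ → X
  vertex (step {X} _ _ w) = X ◂ vertex w

  vertex-0 : (w : Walk C X Z k) → vertex w 0 ≡ X
  vertex-0 (here _)     = refl
  vertex-0 (step _ _ _) = refl

  vertex∈C : (w : Walk C X Z k) (i : ℕ) → vertex w i ∈ᴸ C
  vertex∈C (here X∈C)     _       = X∈C
  vertex∈C (step X∈C _ _) zero    = X∈C
  vertex∈C (step _ _ w)   (suc i) = vertex∈C w i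

  suffix : (w : Walk C X Z k) → i ≤ k → Walk C (vertex w i) Z (k ∸ i)
  suffix {i = zero}  (here X∈C)       _         = here X∈C
  suffix {i = zero}  (step X∈C adj w) _         = step X∈C adj w
  suffix {i = suc i} (step _ _ w)     (s≤s i≤k) = suffix w i≤k

  vertex-suffix : (w : Walk C X Z k) (i≤k : i ≤ k) (t : ℕ) → vertex w (i + t) ≡ vertex (suffix w i≤k) t
  vertex-suffix {i = zero}  (here _)     _         t = refl
  vertex-suffix {i = zero}  (step _ _ _) _         t = refl
  vertex-suffix {i = suc i} (step _ _ w) (s≤s i≤k) t = vertex-suffix w i≤k t

  module _ (∣C∣≡3 : ∀ {X} → X ∈ᴸ C → ∣ X ∣ ≡ 3) where

    -- Keep X followed by the suffix of w from its last facet that is not apart from X.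
    graft : X ∈ᴸ C → Adjacent X Y → (w : Walk C Y Z k) → IsInducedPath (vertex w) k →
            ∃ λ k′ → k′ ≤ suc k × Σ[ w′ ∈ Walk C X Z k′ ] IsInducedPath (vertex w′) k′
    graft {X = X} {k = k} X∈C adj w path
      with last-≤ (λ j → ¬? (apart? X (vertex w j)))
                  (subst (λ V → ¬ Apart X V) (sym (vertex-0 w)) (adjacent⇒¬apart (∣C∣≡3 X∈C) adj)) k
    ... | i , i≤k , near , later
      with ¬apart⇒≡⊎adjacent (∣C∣≡3 X∈C) (∣C∣≡3 (vertex∈C w i)) near
    ...   | inj₁ refl = k ∸ i , m≤n⇒m≤1+n (m∸n≤m k i) , suffix w i≤k , tail
      where
      tail : IsInducedPath (vertex (suffix w i≤k)) (k ∸ i)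
      tail = induced-cong (vertex-suffix w i≤k) (induced-suffix i i≤k path)
    ...   | inj₂ adj′ = suc (k ∸ i) , s≤s (m∸n≤m k i) , step X∈C adj′ (suffix w i≤k) ,
                        induced-cons (∣C∣≡3 X∈C) (subst (Adjacent X) (vertex-suffix w i≤k 0) adj″) far tail
      where
      adj″ : Adjacent X (vertex w (i + 0))
      adj″ = subst (λ j → Adjacent X (vertex w j)) (sym (+-identityʳ i)) adj′
      tail : IsInducedPath (vertex (suffix w i≤k)) (k ∸ i)
      tail = induced-cong (vertex-suffix w i≤k) (induced-suffix i i≤k path)
      far : ∀ {t} → 1 ≤ t → t ≤ k ∸ i → Apart X (vertex (suffix w i≤k) t)
      far {t} 1≤t t≤ = subst (Apart X) (vertex-suffix w i≤k t) (decidable-stable (apart? X _) (later (m<m+n i 1≤t) i+t≤k))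
        where
        i+t≤k : i + t ≤ k
        i+t≤k = ≤-trans (+-monoʳ-≤ i t≤) (≤-reflexive (m+[n∸m]≡n i≤k))

    induced-walk : Walk C X Z k → ∃ λ k′ → k′ ≤ k × Σ[ w′ ∈ Walk C X Z k′ ] IsInducedPath (vertex w′) k′
    induced-walk (here X∈C) = 0 , z≤n , here X∈C , induced-single (∣C∣≡3 X∈C)
    induced-walk (step X∈C adj w) with induced-walk w
    ... | k′ , k′≤k , w′ , path with graft X∈C adj w′ path
    ...   | k″ , k″≤1+k′ , w″ , path″ = k″ , ≤-trans k″≤1+k′ (s≤s k′≤k) , w″ , path″

≤/4 : ∀ {k m} → 4 * k ≤ m → k ≤ m / 4
≤/4 {k} {m} 4k≤m = begin
  k             ≡⟨ m*n/n≡m k 4 ⟨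
  k * 4 / 4     ≤⟨ /-mono-≤ (≤-trans (≤-reflexive (*-comm k 4)) 4k≤m) (≤-refl {4}) ⟩
  m / 4         ∎
  where open ≤-Reasoning

upper-bound : ∀ n → HsAtMost n 3 (n * n / 4)
upper-bound n C pure connected X∈C Y∈C with connected X∈C Y∈C
... | k , w with induced-walk (All.lookup (IsPure.uniform pure)) w
...   | k′ , _ , w′ , path = k′ , ≤/4 (≤-trans (m≤n+m (4 * k′) 6) (induced-path-length path)) , w′

-- Lower bound: the complex spanned by an induced path

module _ {F : ℕ → Subset n} (path : IsInducedPath F L) where

  private
    C : List (Subset n)
    C = applyUpTo F (suc L)

    F∈C : ∀ {i} → i ≤ L → F i ∈ᴸ C
    F∈C i≤L = ∈-applyUpTo⁺ F (s≤s i≤L)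

    index : ∀ {X} → X ∈ᴸ C → ∃ λ i → i ≤ L × X ≡ F i
    index X∈C with ∈-applyUpTo⁻ F X∈C
    ... | i , i<1+L , X≡Fi = i , s≤s⁻¹ i<1+L , X≡Fi

    pure : IsPure n 3 C
    pure = record
      { nonempty = λ ()
      ; uniform  = All.tabulate λ X∈C → let i , i≤L , X≡Fi = index X∈C in trans (cong ∣_∣ X≡Fi) (size path i≤L)
      }

    backward : ∀ {i} → suc i ≤ L → Adjacent (F (suc i)) (F i)
    backward {i} i<L = adjacent-sym {X = F i} {F (suc i)} (trans (size path (<⇒≤ i<L)) (sym (size path i<L))) (adjacent path i<L)

    down : ∀ i → i ≤ L → Walk C (F i) (F 0) i
    down zero    _   = here (F∈C z≤n)
    down (suc i) i<L = step (F∈C i<L) (backward i<L) (down i (<⇒≤ i<L))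

    snoc : ∀ {X Y Z k} → Walk C X Y k → Adjacent Y Z → Z ∈ᴸ C → Walk C X Z (suc k)
    snoc (here X∈C)         adj Z∈C = step X∈C adj (here Z∈C)
    snoc (step X∈C adj′ w)  adj Z∈C = step X∈C adj′ (snoc w adj Z∈C)

    walk-between : ∀ {i} → i ≤ L → ∀ j → j ≤ L → ∃ λ k → Walk C (F i) (F j) k
    walk-between {i} i≤L zero    _   = i , down i i≤L
    walk-between     i≤L (suc j) j<L with walk-between i≤L j (<⇒≤ j<L)
    ... | k , w = suc k , snoc w (adjacent path j<L) (F∈C j<L)

    connected : StronglyConnected C
    connected X∈C Y∈C with index X∈C | index Y∈C
    ... | i , i≤L , refl | j , j≤L , refl = walk-between i≤L j j≤L

    adjacent-index : ∀ {i j} → j ≤ L → Adjacent (F i) (F j) → i ≤ L → j ≤ suc i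
    adjacent-index {i} {j} j≤L adj i≤L with j ≤? suc i
    ... | yes j≤1+i = j≤1+i
    ... | no  j≰1+i = contradiction (apart path (≰⇒> j≰1+i) j≤L) (adjacent⇒¬apart {X = F i} (size path i≤L) adj)

    last-index : ∀ {i} → i ≤ L → F i ≡ F L → L ≤ i
    last-index {i} i≤L Fi≡FL with m≤n⇒m<n∨m≡n i≤L
    ... | inj₂ refl = ≤-refl
    ... | inj₁ i<L with m≤n⇒m<n∨m≡n i<L
    ...   | inj₁ 2+i≤L = contradiction (subst (Apart (F i)) (sym Fi≡FL) (apart path 2+i≤L ≤-refl)) (¬apart-self {X = F i} (size path i≤L))
    ...   | inj₂ refl  = contradiction (subst (Adjacent (F i)) (sym Fi≡FL) (adjacent path i<L)) (¬adjacent-self {X = F i} (size path i≤L))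

    start∈C : ∀ {X Z k} → Walk C X Z k → X ∈ᴸ C
    start∈C (here X∈C)     = X∈C
    start∈C (step X∈C _ _) = X∈C

    -- along a walk the index of the current facet grows by at most one per step
    climb : ∀ {X Z k i} → Walk C X Z k → X ≡ F i → i ≤ L → Z ≡ F L → L ≤ i + k
    climb {i = i} (here _) refl i≤L Z≡FL = ≤-trans (last-index i≤L Z≡FL) (m≤m+n i 0)
    climb {k = suc k} {i} (step _ adj w) refl i≤L Z≡FL with index (start∈C w)
    ... | j , j≤L , refl = begin
      L         ≤⟨ climb w refl j≤L Z≡FL ⟩
      j + k     ≤⟨ +-monoˡ-≤ k (adjacent-index j≤L adj i≤L) ⟩
      suc i + k ≡⟨ +-suc i k ⟨
      i + suc k ∎
      where open ≤-Reasoning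

  induced-path⇒HsAtLeast : HsAtLeast n 3 L
  induced-path⇒HsAtLeast = C , pure , connected , F 0 , F L , F∈C z≤n , F∈C ≤-refl , λ k w → climb w refl z≤n refl

-- Triangles and clocks

-- the singleton {a}, empty when a ≥ n
point : ℕ → Subset n
point {zero}  _       = []
point {suc n} zero    = true ∷ ⊥
point {suc n} (suc a) = false ∷ point a

x∈point⇒toℕx≡a : {x : Fin n} → x ∈ point a → toℕ x ≡ a
x∈point⇒toℕx≡a {suc n} {zero}  {zero}  here        = refl
x∈point⇒toℕx≡a {suc n} {zero}  {suc x} (there x∈⊥) = contradiction x∈⊥ ∉⊥
x∈point⇒toℕx≡a {suc n} {suc a} {suc x} (there x∈)  = cong suc (x∈point⇒toℕx≡a x∈)

toℕx≡a⇒x∈point : {x : Fin n} → toℕ x ≡ a → x ∈ point a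
toℕx≡a⇒x∈point {suc n} {x = zero}  refl = here
toℕx≡a⇒x∈point {suc n} {x = suc x} refl = there (toℕx≡a⇒x∈point refl)

∣point∣ : a < n → ∣ point {n} a ∣ ≡ 1
∣point∣ {zero}  {suc n} _         = cong suc (∣⊥∣≡0 n)
∣point∣ {suc a} {suc n} (s≤s a<n) = ∣point∣ a<n

∣point∪p∣ : (p : Subset n) → a < n → (∀ {x} → x ∈ p → toℕ x ≢ a) → ∣ point a ∪ p ∣ ≡ suc ∣ p ∣
∣point∪p∣ {suc n} {zero}  (false ∷ p) _         _     = cong (λ q → suc ∣ q ∣) (∪-identityˡ p)
∣point∪p∣ {suc n} {zero}  (true ∷ p)  _         fresh = contradiction refl (fresh here)
∣point∪p∣ {suc n} {suc a} (true ∷ p)  (s≤s a<n) fresh = cong suc (∣point∪p∣ p a<n (λ x∈p → fresh (there x∈p) ∘ cong suc))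
∣point∪p∣ {suc n} {suc a} (false ∷ p) (s≤s a<n) fresh = ∣point∪p∣ p a<n (λ x∈p → fresh (there x∈p) ∘ cong suc)

triangle : ℕ → ℕ → ℕ → Subset n
triangle a b c = point a ∪ point b ∪ point c

_∈₃_ : ℕ → ℕ × ℕ × ℕ → Set
u ∈₃ (a , b , c) = u ≡ a ⊎ u ≡ b ⊎ u ≡ c

∈triangle⁻ : {x : Fin n} → x ∈ triangle a b c → toℕ x ∈₃ (a , b , c)
∈triangle⁻ {a = a} {b} {c} x∈ with x∈p∪q⁻ (point a) _ x∈
... | inj₁ x∈a = inj₁ (x∈point⇒toℕx≡a x∈a)
... | inj₂ x∈bc with x∈p∪q⁻ (point b) (point c) x∈bc
...   | inj₁ x∈b = inj₂ (inj₁ (x∈point⇒toℕx≡a x∈b))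
...   | inj₂ x∈c = inj₂ (inj₂ (x∈point⇒toℕx≡a x∈c))

∈triangle⁺ : {x : Fin n} → toℕ x ∈₃ (a , b , c) → x ∈ triangle a b c
∈triangle⁺ (inj₁ eq)        = x∈p∪q⁺ (inj₁ (toℕx≡a⇒x∈point eq))
∈triangle⁺ (inj₂ (inj₁ eq)) = x∈p∪q⁺ (inj₂ (x∈p∪q⁺ (inj₁ (toℕx≡a⇒x∈point eq))))
∈triangle⁺ (inj₂ (inj₂ eq)) = x∈p∪q⁺ (inj₂ (x∈p∪q⁺ (inj₂ (toℕx≡a⇒x∈point eq))))

record Distinct (n a b c : ℕ) : Set where
  field
    a<n : a < n
    b<n : b < n
    c<n : c < n
    a≢b : a ≢ b
    a≢c : a ≢ c
    b≢c : b ≢ c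

∣triangle∣ : Distinct n a b c → ∣ triangle {n} a b c ∣ ≡ 3
∣triangle∣ {n} {a} {b} {c} d = begin
  ∣ triangle {n} a b c ∣          ≡⟨ ∣point∪p∣ (point b ∪ point c) a<n a∉ ⟩
  suc ∣ point {n} b ∪ point c ∣   ≡⟨ cong suc (∣point∪p∣ (point c) b<n b∉) ⟩
  2 + ∣ point {n} c ∣             ≡⟨ cong (2 +_) (∣point∣ c<n) ⟩
  3                               ∎
  where
  open Distinct d
  open ≡-Reasoning
  a∉ : ∀ {x} → x ∈ point b ∪ point c → toℕ x ≢ a
  a∉ x∈ refl with x∈p∪q⁻ (point b) (point c) x∈
  ... | inj₁ x∈b = a≢b (x∈point⇒toℕx≡a x∈b)
  ... | inj₂ x∈c = a≢c (x∈point⇒toℕx≡a x∈c)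
  b∉ : ∀ {x} → x ∈ point c → toℕ x ≢ b
  b∉ x∈c refl = b≢c (x∈point⇒toℕx≡a x∈c)

∉₃ : ∀ {w} → w ≢ a → w ≢ b → w ≢ c → ¬ w ∈₃ (a , b , c)
∉₃ w≢a _ _ (inj₁ w≡a)        = w≢a w≡a
∉₃ _ w≢b _ (inj₂ (inj₁ w≡b)) = w≢b w≡b
∉₃ _ _ w≢c (inj₂ (inj₂ w≡c)) = w≢c w≡c

∈₃⇒< : ∀ {u} → Distinct n a b c → u ∈₃ (a , b , c) → u < n
∈₃⇒< d (inj₁ refl)        = Distinct.a<n d
∈₃⇒< d (inj₂ (inj₁ refl)) = Distinct.b<n d
∈₃⇒< d (inj₂ (inj₂ refl)) = Distinct.c<n d

triangle-adjacent : ∀ {a′ b′ c′ u v w} → Distinct n a b c →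
  u ∈₃ (a , b , c) → u ∈₃ (a′ , b′ , c′) → v ∈₃ (a , b , c) → v ∈₃ (a′ , b′ , c′) → u ≢ v →
  w ∈₃ (a , b , c) → ¬ w ∈₃ (a′ , b′ , c′) → Adjacent (triangle {n} a b c) (triangle a′ b′ c′)
triangle-adjacent {n} {a} {b} {c} {a′} {b′} {c′} d u∈ u∈′ v∈ v∈′ u≢v w∈ w∉′ =
  shared-pair⇒adjacent (∣triangle∣ d) x≢y (in-both u∈ u∈′) (in-both v∈ v∈′)
    (∈triangle⁺ (subst (_∈₃ _) (sym (toℕ-pt w∈)) w∈)) (λ x∈ → w∉′ (subst (_∈₃ _) (toℕ-pt w∈) (∈triangle⁻ x∈)))
  where
  pt : ∀ {t} → t ∈₃ (a , b , c) → Fin n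
  pt t∈ = fromℕ< (∈₃⇒< d t∈)
  toℕ-pt : ∀ {t} (t∈ : t ∈₃ (a , b , c)) → toℕ (pt t∈) ≡ t
  toℕ-pt t∈ = toℕ-fromℕ< (∈₃⇒< d t∈)
  in-both : ∀ {t} (t∈ : t ∈₃ (a , b , c)) → t ∈₃ (a′ , b′ , c′) → pt t∈ ∈ triangle a b c ∩ triangle a′ b′ c′
  in-both t∈ t∈′ = x∈p∩q⁺ (∈triangle⁺ (subst (_∈₃ _) (sym (toℕ-pt t∈)) t∈) , ∈triangle⁺ (subst (_∈₃ _) (sym (toℕ-pt t∈)) t∈′))
  x≢y : pt u∈ ≢ pt v∈
  x≢y eq = u≢v (trans (sym (toℕ-pt u∈)) (trans (cong toℕ eq) (toℕ-pt v∈)))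

module Clock (clock : ℕ → ℕ → ℕ) (clock-sym : ∀ u v → clock u v ≡ clock v u) where

  -- the pair {u, v} may lie only in the facets with indices clock u v and clock u v + 1
  OnTime : ℕ → ℕ → ℕ → Set
  OnTime i u v = clock u v ≤ i × i ≤ suc (clock u v)

  OnTime₃ : ℕ → ℕ × ℕ × ℕ → Set
  OnTime₃ i (a , b , c) = OnTime i a b × OnTime i a c × OnTime i b c

  on-time-sym : ∀ {i u v} → OnTime i u v → OnTime i v u
  on-time-sym {i} {u} {v} = subst (λ t → t ≤ i × i ≤ suc t) (clock-sym u v)

  on-time : ∀ {i u v T} → OnTime₃ i T → u ∈₃ T → v ∈₃ T → u ≢ v → OnTime i u v
  on-time _              (inj₁ refl)        (inj₁ refl)        u≢v = contradiction refl u≢v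
  on-time (ab , _ , _)   (inj₁ refl)        (inj₂ (inj₁ refl)) _   = ab
  on-time (_ , ac , _)   (inj₁ refl)        (inj₂ (inj₂ refl)) _   = ac
  on-time (ab , _ , _)   (inj₂ (inj₁ refl)) (inj₁ refl)        _   = on-time-sym ab
  on-time _              (inj₂ (inj₁ refl)) (inj₂ (inj₁ refl)) u≢v = contradiction refl u≢v
  on-time (_ , _ , bc)   (inj₂ (inj₁ refl)) (inj₂ (inj₂ refl)) _   = bc
  on-time (_ , ac , _)   (inj₂ (inj₂ refl)) (inj₁ refl)        _   = on-time-sym ac
  on-time (_ , _ , bc)   (inj₂ (inj₂ refl)) (inj₂ (inj₁ refl)) _   = on-time-sym bc
  on-time _              (inj₂ (inj₂ refl)) (inj₂ (inj₂ refl)) u≢v = contradiction refl u≢v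

  on-time⇒apart : ∀ {n i j a b c a′ b′ c′} → OnTime₃ i (a , b , c) → OnTime₃ j (a′ , b′ , c′) → 2 + i ≤ j →
                  Apart (triangle {n} a b c) (triangle a′ b′ c′)
  on-time⇒apart {n} {i} {j} {a} {b} {c} {a′} {b′} {c′} ti tj i<j = ∣∩∣≤1 (≮⇒≥ shared-pair)
    where
    shared-pair : ¬ 1 < ∣ triangle {n} a b c ∩ triangle a′ b′ c′ ∣
    shared-pair 2≤∣∩∣ with 2≤∣p∣⇒distinct {p = triangle {n} a b c ∩ triangle a′ b′ c′} 2≤∣∩∣
    ... | x , y , x≢y , x∈ , y∈ with x∈p∩q⁻ _ _ x∈ | x∈p∩q⁻ _ _ y∈
    ...   | x∈T , x∈T′ | y∈T , y∈T′ = <⇒≱ i<j (≤-trans j≤1+clock (s≤s clock≤i))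
      where
      toℕx≢toℕy : toℕ x ≢ toℕ y
      toℕx≢toℕy = x≢y ∘ toℕ-injective
      clock≤i = proj₁ (on-time ti (∈triangle⁻ x∈T) (∈triangle⁻ y∈T) toℕx≢toℕy)
      j≤1+clock = proj₂ (on-time tj (∈triangle⁻ x∈T′) (∈triangle⁻ y∈T′) toℕx≢toℕy)

-- Chains of fans

-- Fan j has apex `apex j` and rim `rim j 0, …, rim j P`; its facets {apex j, rim j t, rim j (t + 1)},
-- t < P, are the facets j * P + t of the sequence, and consecutive fans share the edge
-- {rim j P′, rim j P} = {rim (j + 1) 0, apex (j + 1)}. Only the facets up to L must lie in [n].
record IsFanChain (n P′ b L : ℕ) (apex : ℕ → ℕ) (rim : ℕ → ℕ → ℕ) (clock : ℕ → ℕ → ℕ) : Set where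
  P : ℕ
  P = suc P′
  field
    apex∉rim    : ∀ {j t} → j < b → t ≤ P → apex j ≢ rim j t
    rim-step    : ∀ {j t} → j < b → t < P → rim j t ≢ rim j (suc t)
    rim-skip    : ∀ {j t} → j < b → 2 + t ≤ P → rim j t ≢ rim j (2 + t)
    next-apex   : ∀ {j} → suc j < b → rim j P ≡ apex (suc j)
    next-rim    : ∀ {j} → suc j < b → rim j P′ ≡ rim (suc j) 0
    junction    : ∀ {j} → suc j < b → apex j ≢ rim (suc j) 1
    bounded     : ∀ {j t} → t < P → j * P + t ≤ L → apex j < n × rim j t < n × rim j (suc t) < n
    clock-sym   : ∀ u v → clock u v ≡ clock v u
    clock-spoke : ∀ {j t} → j < b → t ≤ P → clock (apex j) (rim j t) ≡ j * P + t ∸ 1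
    clock-rim   : ∀ {j t} → j < b → t < P → clock (rim j t) (rim j (suc t)) ≡ j * P + t
    length      : L < b * P

module _ {n P′ b L apex rim clock} (chain : IsFanChain n P′ b L apex rim clock) where

  open IsFanChain chain
  open Clock clock clock-sym

  fan-facet : ℕ → ℕ → Subset n
  fan-facet j t = triangle (apex j) (rim j t) (rim j (suc t))

  facet : ℕ → Subset n
  facet i = fan-facet (i / P) (i % P)

  private
    split : ∀ {j t} → t < P → (j * P + t) / P ≡ j × (j * P + t) % P ≡ t
    split {j} {t} t<P = quotient , remainder
      where
      quotient : (j * P + t) / P ≡ j
      quotient = trans (+-distrib-/-∣ˡ t (divides-refl j))
                       (trans (cong₂ _+_ (m*n/n≡m j P) (m<n⇒m/n≡0 t<P)) (+-identityʳ j))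
      remainder : (j * P + t) % P ≡ t
      remainder = trans (cong (_% P) (+-comm (j * P) t)) (trans ([m+kn]%n≡m%n t j P) (m<n⇒m%n≡m t<P))

    facet-at : ∀ {j t} → t < P → facet (j * P + t) ≡ fan-facet j t
    facet-at {j} t<P = let q , r = split {j} t<P in cong₂ fan-facet q r

    by-blocks : {Q : ℕ → Set} → (∀ j t → t < P → Q (j * P + t)) → ∀ i → Q i
    by-blocks {Q} h i = subst Q (sym (trans (m≡m%n+[m/n]*n i P) (+-comm (i % P) _))) (h (i / P) (i % P) (m%n<n i P))

    block< : ∀ {j t} → j * P + t ≤ L → j < b
    block< {j} {t} i≤L = *-cancelʳ-< P j b (≤-<-trans (≤-trans (m≤m+n (j * P) t) i≤L) length)

    distinct : ∀ {j t} → t < P → j * P + t ≤ L → Distinct n (apex j) (rim j t) (rim j (suc t))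
    distinct t<P i≤L with bounded t<P i≤L
    ... | a<n , r<n , r′<n = record
      { a<n = a<n ; b<n = r<n ; c<n = r′<n
      ; a≢b = apex∉rim j<b (<⇒≤ t<P) ; a≢c = apex∉rim j<b t<P ; b≢c = rim-step j<b t<P }
      where j<b = block< i≤L

    within-fan : ∀ {j t} → suc t < P → j * P + suc t ≤ L → Adjacent (fan-facet j t) (fan-facet j (suc t))
    within-fan {j} {t} t+1<P i+1≤L =
      triangle-adjacent (distinct (<⇒≤ t+1<P) i≤L)
        (inj₁ refl) (inj₁ refl) (inj₂ (inj₂ refl)) (inj₂ (inj₁ refl)) (apex∉rim j<b (<⇒≤ t+1<P))
        (inj₂ (inj₁ refl)) (∉₃ (≢-sym (apex∉rim j<b (<⇒≤ (<⇒≤ t+1<P)))) (rim-step j<b (<⇒≤ t+1<P)) (rim-skip j<b t+1<P))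
      where
      i≤L = ≤-trans (+-monoʳ-≤ (j * P) (n≤1+n t)) i+1≤L
      j<b = block< i≤L

    across-fans : ∀ {j} → suc j * P ≤ L → Adjacent (fan-facet j P′) (fan-facet (suc j) 0)
    across-fans {j} j+1≤L =
      triangle-adjacent (distinct ≤-refl i≤L)
        (inj₂ (inj₂ (sym (next-apex j+1<b)))) (inj₁ refl) (inj₂ (inj₁ (sym (next-rim j+1<b)))) (inj₂ (inj₁ refl))
        (apex∉rim j+1<b z≤n)
        (inj₁ refl) (∉₃ (subst (apex j ≢_) (next-apex j+1<b) (apex∉rim j<b ≤-refl))
                        (subst (apex j ≢_) (next-rim j+1<b) (apex∉rim j<b (n≤1+n P′)))
                        (junction j+1<b))
      where
      i≤L : j * P + P′ ≤ L
      i≤L = ≤-trans (≤-trans (≤-reflexive (+-comm (j * P) P′)) (n≤1+n _)) j+1≤L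
      j+1<b : suc j < b
      j+1<b = block< {t = 0} (subst (_≤ L) (sym (+-identityʳ _)) j+1≤L)
      j<b = block< i≤L

    on-time-at : ∀ {j t} → j < b → t < P → OnTime₃ (j * P + t) (apex j , rim j t , rim j (suc t))
    on-time-at {j} {t} j<b t<P =
        window (clock-spoke j<b (<⇒≤ t<P)) (m∸n≤m i 1 , i≤1+[i∸1] i)
      , window (trans (clock-spoke j<b t<P) (cong (_∸ 1) (+-suc (j * P) t))) (≤-refl , n≤1+n i)
      , window (clock-rim j<b t<P) (≤-refl , n≤1+n i)
      where
      i = j * P + t
      window : ∀ {u v c} → clock u v ≡ c → c ≤ i × i ≤ suc c → OnTime i u v
      window refl w = w
      i≤1+[i∸1] : ∀ m → m ≤ suc (m ∸ 1)
      i≤1+[i∸1] zero    = z≤n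
      i≤1+[i∸1] (suc m) = ≤-refl

  fan-chain-induced : IsInducedPath facet L
  fan-chain-induced = record
    { size     = λ {i} → by-blocks {λ i → i ≤ L → ∣ facet i ∣ ≡ 3} size-at i
    ; adjacent = λ {i} → by-blocks {λ i → i < L → Adjacent (facet i) (facet (suc i))} adjacent-at i
    ; apart    = λ {i} {i′} → by-blocks {λ i → 2 + i ≤ i′ → i′ ≤ L → Apart (facet i) (facet i′)}
                                (λ j t t<P → by-blocks {λ i′ → 2 + (j * P + t) ≤ i′ → i′ ≤ L → Apart (facet (j * P + t)) (facet i′)}
                                               (apart-at j t t<P) i′) i
    }
    where
    size-at : ∀ j t → t < P → j * P + t ≤ L → ∣ facet (j * P + t) ∣ ≡ 3
    size-at j t t<P i≤L = subst (λ X → ∣ X ∣ ≡ 3) (sym (facet-at {j} t<P)) (∣triangle∣ (distinct {j} t<P i≤L))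

    adjacent-at : ∀ j t → t < P → j * P + t < L → Adjacent (facet (j * P + t)) (facet (suc (j * P + t)))
    adjacent-at j t t<P i<L with m≤n⇒m<n∨m≡n t<P
    ... | inj₁ t+1<P = subst₂ Adjacent (sym (facet-at {j} t<P)) (sym (trans (cong facet (sym (+-suc (j * P) t))) (facet-at {j} t+1<P)))
                         (within-fan t+1<P (subst (_≤ L) (sym (+-suc (j * P) t)) i<L))
    ... | inj₂ refl  = subst₂ Adjacent (sym (facet-at {j} t<P)) (sym (trans (cong facet next-block) (facet-at {suc j} z<s)))
                         (across-fans (subst (_≤ L) (trans (sym (+-suc (j * P) P′)) (+-comm (j * P) P)) i<L))
      where
      next-block : suc (j * P + P′) ≡ suc j * P + 0
      next-block = trans (sym (+-suc (j * P) P′)) (trans (+-comm (j * P) P) (sym (+-identityʳ _)))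

    apart-at : ∀ j t → t < P → ∀ j′ t′ → t′ < P → 2 + (j * P + t) ≤ j′ * P + t′ → j′ * P + t′ ≤ L →
               Apart (facet (j * P + t)) (facet (j′ * P + t′))
    apart-at j t t<P j′ t′ t′<P i<i′ i′≤L =
      subst₂ Apart (sym (facet-at {j} t<P)) (sym (facet-at {j′} t′<P))
        (on-time⇒apart (on-time-at (block< i≤L) t<P) (on-time-at (block< i′≤L) t′<P) i<i′)
      where
      i≤L = ≤-trans (≤-trans (n≤1+n _) (n≤1+n _)) (≤-trans i<i′ i′≤L)

-- Walecki's zigzag paths

-- interleave e o is the sequence e 0, o 0, e 1, o 1, …
interleave : (ℕ → ℕ) → (ℕ → ℕ) → ℕ → ℕ
interleave e o zero    = e zero
interleave e o (suc s) = interleave o (λ l → e (suc l)) s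

interleave-even : ∀ e o l → interleave e o (l + l) ≡ e l
interleave-even e o zero    = refl
interleave-even e o (suc l) rewrite +-suc l l = interleave-even (λ l → e (suc l)) (λ l → o (suc l)) l

interleave-odd : ∀ e o l → interleave e o (suc (l + l)) ≡ o l
interleave-odd e o l = interleave-even o (λ l → e (suc l)) l

even-or-odd : ∀ s → ∃ λ l → s ≡ l + l ⊎ s ≡ suc (l + l)
even-or-odd zero = 0 , inj₁ refl
even-or-odd (suc s) with even-or-odd s
... | l , inj₁ refl = l , inj₂ refl
... | l , inj₂ refl = suc l , inj₁ (cong suc (sym (+-suc l l)))

⌊1+n+n/2⌋≡n : ∀ n → ⌊ suc (n + n) /2⌋ ≡ n
⌊1+n+n/2⌋≡n zero    = refl
⌊1+n+n/2⌋≡n (suc n) rewrite +-suc n n = cong suc (⌊1+n+n/2⌋≡n n)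

[m%d+n]%d≡[m+n]%d : ∀ a b d .{{_ : Data.Nat.NonZero d}} → (a % d + b) % d ≡ (a + b) % d
[m%d+n]%d≡[m+n]%d a b d = begin
  (a % d + b) % d         ≡⟨ %-distribˡ-+ (a % d) b d ⟩
  (a % d % d + b % d) % d ≡⟨ cong (λ x → (x + b % d) % d) (m%n%n≡m%n a d) ⟩
  (a % d + b % d) % d     ≡⟨ %-distribˡ-+ a b d ⟨
  (a + b) % d             ∎
  where open ≡-Reasoning

double-≤⁻¹ : ∀ {a b} → a + a ≤ b + b → a ≤ b
double-≤⁻¹ h = ≮⇒≥ (λ b<a → <⇒≱ (+-mono-< b<a b<a) h)

double-<⁻¹ : ∀ {a b} → a + a < b + b → a < b
double-<⁻¹ h = ≰⇒> (λ b≤a → <⇒≱ h (+-mono-≤ b≤a b≤a))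

module Zigzag (k : ℕ) where

  m : ℕ
  m = suc (k + k)

  -- the displacements 0, +1, -1, +2, -2, … as residues mod m
  zigzag : ℕ → ℕ
  zigzag = interleave (m ∸_) suc

  -- the j-th zigzag path of Walecki's decomposition of the complete graph on ℤ/m
  walecki : ℕ → ℕ → ℕ
  walecki j s = (j + zigzag s) % m

  unzigzag : ℕ → ℕ
  unzigzag d = if does (d ≤? k) then d + d ∸ 1 else (m ∸ d) + (m ∸ d)

  position : ℕ → ℕ → ℕ
  position j x = unzigzag ((x + (m ∸ j)) % m)

  unzigzag-low : ∀ {d} → d ≤ k → unzigzag d ≡ d + d ∸ 1
  unzigzag-low {d} d≤k rewrite dec-true (d ≤? k) d≤k = refl

  unzigzag-high : ∀ {d} → k < d → unzigzag d ≡ (m ∸ d) + (m ∸ d)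
  unzigzag-high {d} k<d rewrite dec-false (d ≤? k) (<⇒≱ k<d) = refl

  unzigzag-zigzag : ∀ s → s < m → unzigzag (zigzag s % m) ≡ s
  unzigzag-zigzag s s<m with even-or-odd s
  ... | zero , inj₁ refl = trans (cong unzigzag (n%n≡0 m)) (unzigzag-low z≤n)
  ... | suc l , inj₁ refl = begin
    unzigzag (zigzag (suc l + suc l) % m) ≡⟨ cong (λ d → unzigzag (d % m)) (interleave-even (m ∸_) suc (suc l)) ⟩
    unzigzag ((m ∸ suc l) % m)            ≡⟨ cong unzigzag (m<n⇒m%n≡m (s≤s (m∸n≤m (k + k) l))) ⟩
    unzigzag (m ∸ suc l)                  ≡⟨ unzigzag-high k<m∸[1+l] ⟩
    (m ∸ (m ∸ suc l)) + (m ∸ (m ∸ suc l)) ≡⟨ cong (λ x → x + x) (m∸[m∸n]≡n (≤-trans l<k (≤-trans (m≤m+n k k) (n≤1+n _)))) ⟩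
    suc l + suc l                         ∎
    where
    open ≡-Reasoning
    l<k : suc l ≤ k
    l<k = double-≤⁻¹ (s≤s⁻¹ s<m)
    k<m∸[1+l] : k < m ∸ suc l
    k<m∸[1+l] = m+n≤o⇒m≤o∸n (suc k) (≤-trans (≤-reflexive (sym (+-suc k l))) (+-monoʳ-≤ k l<k))
  ... | l , inj₂ refl = begin
    unzigzag (zigzag (suc (l + l)) % m) ≡⟨ cong (λ d → unzigzag (d % m)) (interleave-odd (m ∸_) suc l) ⟩
    unzigzag (suc l % m)                ≡⟨ cong unzigzag (m<n⇒m%n≡m (s≤s (≤-trans l<k (m≤m+n k k)))) ⟩
    unzigzag (suc l)                    ≡⟨ unzigzag-low l<k ⟩
    suc l + suc l ∸ 1                   ≡⟨ +-suc l l ⟩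
    suc (l + l)                         ∎
    where
    open ≡-Reasoning
    l<k : l < k
    l<k = double-<⁻¹ (s≤s⁻¹ s<m)

  walecki<m : ∀ j s → walecki j s < m
  walecki<m j s = m%n<n (j + zigzag s) m

  position-walecki : ∀ {j s} → j ≤ m → s < m → position j (walecki j s) ≡ s
  position-walecki {j} {s} j≤m s<m = begin
    unzigzag (((j + zigzag s) % m + (m ∸ j)) % m) ≡⟨ cong unzigzag ([m%d+n]%d≡[m+n]%d (j + zigzag s) (m ∸ j) m) ⟩
    unzigzag ((j + zigzag s + (m ∸ j)) % m)       ≡⟨ cong (λ x → unzigzag (x % m)) rearrange ⟩
    unzigzag ((zigzag s + m) % m)                 ≡⟨ cong unzigzag ([m+n]%n≡m%n (zigzag s) m) ⟩
    unzigzag (zigzag s % m)                       ≡⟨ unzigzag-zigzag s s<m ⟩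
    s                                             ∎
    where
    open ≡-Reasoning
    rearrange : j + zigzag s + (m ∸ j) ≡ zigzag s + m
    rearrange = trans (cong (_+ (m ∸ j)) (+-comm j (zigzag s)))
                      (trans (+-assoc (zigzag s) j (m ∸ j)) (cong (zigzag s +_) (m+[n∸m]≡n j≤m)))

  walecki-first : ∀ {j} → j < m → walecki j 0 ≡ j
  walecki-first {j} j<m = trans ([m+n]%n≡m%n j m) (m<n⇒m%n≡m j<m)

  walecki-last : ∀ {j} → j < k → walecki j (k + k) ≡ j + suc k
  walecki-last {j} j<k = begin
    (j + zigzag (k + k)) % m ≡⟨ cong (λ z → (j + z) % m) (interleave-even (m ∸_) suc k) ⟩
    (j + (m ∸ k)) % m        ≡⟨ cong (λ z → (j + z) % m) (m+n∸n≡m (suc k) k) ⟩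
    (j + suc k) % m          ≡⟨ m<n⇒m%n≡m (s≤s (≤-trans (≤-reflexive (+-suc j k)) (+-monoˡ-≤ k j<k))) ⟩
    j + suc k                ∎
    where open ≡-Reasoning

  -- the zigzag whose path uses the edge {x, y}
  block : ℕ → ℕ → ℕ
  block x y = ⌊ (x + y) % m /2⌋

  block-walecki : ∀ {j s} → j < k → suc s < m → block (walecki j s) (walecki j (suc s)) ≡ j
  block-walecki {j} {s} j<k s+1<m with even-or-odd s
  ... | l , inj₁ refl = begin
    ⌊ (walecki j (l + l) + walecki j (suc (l + l))) % m /2⌋ ≡⟨ cong ⌊_/2⌋ (sym (%-distribˡ-+ (j + zigzag (l + l)) (j + zigzag (suc (l + l))) m)) ⟩
    ⌊ (j + zigzag (l + l) + (j + zigzag (suc (l + l)))) % m /2⌋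
      ≡⟨ cong₂ (λ a b → ⌊ (j + a + (j + b)) % m /2⌋) (interleave-even (m ∸_) suc l) (interleave-odd (m ∸_) suc l) ⟩
    ⌊ (j + (m ∸ l) + (j + suc l)) % m /2⌋ ≡⟨ cong (λ x → ⌊ x % m /2⌋) (trans (shuffle j (m ∸ l) l) (cong (suc (j + j) +_) (m∸n+n≡m l≤m))) ⟩
    ⌊ (suc (j + j) + m) % m /2⌋           ≡⟨ cong ⌊_/2⌋ (trans ([m+n]%n≡m%n (suc (j + j)) m) (m<n⇒m%n≡m (s≤s (+-mono-< j<k j<k)))) ⟩
    ⌊ suc (j + j) /2⌋                     ≡⟨ ⌊1+n+n/2⌋≡n j ⟩
    j                                     ∎
    where
    open ≡-Reasoning
    l≤m : l ≤ m
    l≤m = ≤-trans (m≤m+n l l) (<⇒≤ (<⇒≤ s+1<m))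
    shuffle : ∀ j d l → j + d + (j + suc l) ≡ suc (j + j) + (d + l)
    shuffle = solve-∀
  ... | l , inj₂ refl = begin
    ⌊ (walecki j (suc (l + l)) + walecki j (suc (suc (l + l)))) % m /2⌋
      ≡⟨ cong (λ s → ⌊ (walecki j (suc (l + l)) + walecki j s) % m /2⌋) (cong suc (+-suc l l)) ⟨
    ⌊ (walecki j (suc (l + l)) + walecki j (suc l + suc l)) % m /2⌋ ≡⟨ cong ⌊_/2⌋ (sym (%-distribˡ-+ (j + zigzag (suc (l + l))) (j + zigzag (suc l + suc l)) m)) ⟩
    ⌊ (j + zigzag (suc (l + l)) + (j + zigzag (suc l + suc l))) % m /2⌋
      ≡⟨ cong₂ (λ a b → ⌊ (j + a + (j + b)) % m /2⌋) (interleave-odd (m ∸_) suc l) (interleave-even (m ∸_) suc (suc l)) ⟩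
    ⌊ (j + suc l + (j + (m ∸ suc l))) % m /2⌋ ≡⟨ cong (λ x → ⌊ x % m /2⌋) (trans (shuffle j (m ∸ suc l) (suc l)) (cong (j + j +_) (m∸n+n≡m l<m))) ⟩
    ⌊ (j + j + m) % m /2⌋                     ≡⟨ cong ⌊_/2⌋ (trans ([m+n]%n≡m%n (j + j) m) (m<n⇒m%n≡m (≤-trans (+-mono-< j<k j<k) (n≤1+n _)))) ⟩
    ⌊ j + j /2⌋                               ≡⟨ n≡⌊n+n/2⌋ j ⟨
    j                                         ∎
    where
    open ≡-Reasoning
    l<m : suc l ≤ m
    l<m = ≤-trans (s≤s (m≤m+n l l)) (<⇒≤ (<⇒≤ s+1<m))
    shuffle : ∀ j d l → j + l + (j + d) ≡ j + j + (d + l)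
    shuffle = solve-∀

-- Fans over zigzag paths

parity[1+n]≢parity[n] : ∀ j → parity (suc j) ≢ parity j
parity[1+n]≢parity[n] zero          ()
parity[1+n]≢parity[n] (suc zero)    ()
parity[1+n]≢parity[n] (suc (suc j)) = parity[1+n]≢parity[n] j

-- The vertices are the base vertices 0, …, 2k, two wings w₀, w₁ and the apexes a₀, a₁, ….
-- Fan j has apex a_j and rim w_{j+1}, z_j(0), …, z_j(2k), w_j, a_{j+1}, where z_j is the j-th
-- zigzag path on the base vertices and w_j is the wing indexed by the parity of j.
module WaleckiFans (k : ℕ) where

  open Zigzag k

  P : ℕ
  P = suc (suc m)

  data Vertex : Set where
    base : ℕ → Vertex
    wing : Parity → Vertex
    apex : ℕ → Vertex

  Valid : Vertex → Set
  Valid (base x) = x < m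
  Valid (wing _) = ⊤
  Valid (apex _) = ⊤

  ⌜_⌝ : Vertex → ℕ
  ⌜ base x ⌝   = x
  ⌜ wing 0ℙ ⌝  = m + 0
  ⌜ wing 1ℙ ⌝  = m + 1
  ⌜ apex j ⌝   = m + suc (suc j)

  decode : ℕ → Vertex
  decode zero          = wing 0ℙ
  decode (suc zero)    = wing 1ℙ
  decode (suc (suc j)) = apex j

  kind : ℕ → Vertex
  kind u = if does (u <? m) then base u else decode (u ∸ m)

  kind-above : ∀ d → kind (m + d) ≡ decode d
  kind-above d = trans (cong (λ b → if b then base (m + d) else decode (m + d ∸ m)) (dec-false ((m + d) <? m) (m+n≮m m d)))
                       (cong decode (m+n∸m≡n m d))

  kind-⌜⌝ : ∀ v → Valid v → kind ⌜ v ⌝ ≡ v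
  kind-⌜⌝ (base x) x<m = cong (λ b → if b then base x else decode (x ∸ m)) (dec-true (x <? m) x<m)
  kind-⌜⌝ (wing 0ℙ) _  = kind-above 0
  kind-⌜⌝ (wing 1ℙ) _  = kind-above 1
  kind-⌜⌝ (apex j)  _  = kind-above (suc (suc j))

  ⌜⌝-injective : ∀ {u v} → Valid u → Valid v → ⌜ u ⌝ ≡ ⌜ v ⌝ → u ≡ v
  ⌜⌝-injective {u} {v} valid-u valid-v eq = trans (sym (kind-⌜⌝ u valid-u)) (trans (cong kind eq) (kind-⌜⌝ v valid-v))

  rim : ℕ → ℕ → Vertex
  rim j zero    = wing (parity (suc j))
  rim j (suc s) = if does (s <? m) then base (walecki j s)
                  else if does (s ≟ m) then wing (parity j) else apex (suc j)

  rim-path : ∀ {j s} → s < m → rim j (suc s) ≡ base (walecki j s)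
  rim-path {j} {s} s<m rewrite dec-true (s <? m) s<m = refl

  rim-wing : ∀ j → rim j (suc m) ≡ wing (parity j)
  rim-wing j rewrite dec-false (m <? m) (<-irrefl refl) | dec-true (m ≟ m) refl = refl

  rim-apex : ∀ j → rim j P ≡ apex (suc j)
  rim-apex j rewrite dec-false (suc m <? m) (λ m+1<m → <-asym m+1<m (n<1+n m))
                   | dec-false (suc m ≟ m) (λ m+1≡m → <-irrefl (sym m+1≡m) (n<1+n m)) = refl

  data Segment (t : ℕ) : Set where
    start : t ≡ 0 → Segment t
    path  : ∀ s → s < m → t ≡ suc s → Segment t
    end   : t ≡ suc m → Segment t
    next  : t ≡ P → Segment t

  segment : ∀ {t} → t ≤ P → Segment t
  segment {zero}  _ = start refl
  segment {suc s} t≤P with s <? m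
  ... | yes s<m = path s s<m refl
  ... | no  s≮m with m≤n⇒m<n∨m≡n (≮⇒≥ s≮m)
  ...   | inj₂ refl = end refl
  ...   | inj₁ m<s  = next (cong suc (≤-antisym (s≤s⁻¹ t≤P) m<s))

  -- inverse of rim j on the rim of the j-th fan
  rim-index : ℕ → Vertex → ℕ
  rim-index j (base x) = suc (position j x)
  rim-index j (wing π) = if does (π ≟ℙ parity j) then suc m else 0
  rim-index j (apex _) = P

  rim-index-rim : ∀ {j t} → j < k → t ≤ P → rim-index j (rim j t) ≡ t
  rim-index-rim {j} {t} j<k t≤P with segment t≤P
  ... | start refl = cong (λ b → if b then suc m else 0) (dec-false (parity (suc j) ≟ℙ parity j) (parity[1+n]≢parity[n] j))
  ... | path s s<m refl = trans (cong (rim-index j) (rim-path s<m))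
                                (cong suc (position-walecki (≤-trans (<⇒≤ j<k) (≤-trans (m≤m+n k k) (n≤1+n _))) s<m))
  ... | end refl = trans (cong (rim-index j) (rim-wing j)) (cong (λ b → if b then suc m else 0) (dec-true (parity j ≟ℙ parity j) refl))
  ... | next refl = cong (rim-index j) (rim-apex j)

  rim-injective : ∀ {j t t′} → j < k → t ≤ P → t′ ≤ P → rim j t ≡ rim j t′ → t ≡ t′
  rim-injective j<k t≤P t′≤P eq = trans (sym (rim-index-rim j<k t≤P)) (trans (cong (rim-index _) eq) (rim-index-rim j<k t′≤P))

  rim-valid : ∀ j t → Valid (rim j t)
  rim-valid j zero = tt
  rim-valid j (suc s) with s <? m
  ... | yes s<m = subst Valid (sym (rim-path s<m)) (walecki<m j s)
  ... | no  s≮m rewrite dec-false (s <? m) s≮m with does (s ≟ m)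
  ...   | true  = tt
  ...   | false = tt

  wing-fan : ℕ → ℕ
  wing-fan x = if does (x <? k) then x else x ∸ suc k

  -- the fan whose rim contains the edge {u, v}, when neither u nor v is an apex
  fan : Vertex → Vertex → ℕ
  fan (base x) (base y) = block x y
  fan (base x) (wing _) = wing-fan x
  fan (wing _) (base x) = wing-fan x
  fan _        _        = 0

  clock : Vertex → Vertex → ℕ
  clock (apex i) (apex j) = (i ⊓ j) * P + suc m
  clock (apex j) v        = j * P + rim-index j v ∸ 1
  clock u        (apex j) = j * P + rim-index j u ∸ 1
  clock u        v        = fan u v * P + (rim-index (fan u v) u ⊓ rim-index (fan u v) v)

  clock-sym : ∀ u v → clock u v ≡ clock v u
  clock-sym (apex i) (apex j) = cong (λ x → x * P + suc m) (⊓-comm i j)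
  clock-sym (apex _) (base _) = refl
  clock-sym (apex _) (wing _) = refl
  clock-sym (base _) (apex _) = refl
  clock-sym (wing _) (apex _) = refl
  clock-sym (base x) (base y) rewrite +-comm x y = cong (block y x * P +_) (⊓-comm _ _)
  clock-sym (base x) (wing _) = cong (wing-fan x * P +_) (⊓-comm _ _)
  clock-sym (wing _) (base x) = cong (wing-fan x * P +_) (⊓-comm _ _)
  clock-sym (wing _) (wing _) = cong (0 * P +_) (⊓-comm _ _)

  data NonApex : Vertex → Set where
    base : ∀ {x} → NonApex (base x)
    wing : ∀ {π} → NonApex (wing π)

  rim-nonapex : ∀ {j t} → t < P → NonApex (rim j t)
  rim-nonapex {j} t<P with segment (<⇒≤ t<P)
  ... | start refl      = wing
  ... | path s s<m refl = subst NonApex (sym (rim-path s<m)) base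
  ... | end refl        = subst NonApex (sym (rim-wing j)) wing
  ... | next refl       = contradiction t<P (<-irrefl refl)

  clock-nonapex : ∀ {u v} → NonApex u → NonApex v →
                  clock u v ≡ fan u v * P + (rim-index (fan u v) u ⊓ rim-index (fan u v) v)
  clock-nonapex base base = refl
  clock-nonapex base wing = refl
  clock-nonapex wing base = refl
  clock-nonapex wing wing = refl

  clock-apex : ∀ j {v} → NonApex v → clock (apex j) v ≡ j * P + rim-index j v ∸ 1
  clock-apex j base = refl
  clock-apex j wing = refl

  fan-rim : ∀ {j t} → j < k → t < suc m → fan (rim j t) (rim j (suc t)) ≡ j
  fan-rim {j} {t} j<k t<1+m with segment (≤-trans (<⇒≤ t<1+m) (n≤1+n _))
  ... | start refl rewrite rim-path {j} {0} z<s | walecki-first (≤-trans j<k (≤-trans (m≤m+n k k) (n≤1+n _))) =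
    cong (λ b → if b then j else j ∸ suc k) (dec-true (j <? k) j<k)
  ... | path s s<m refl with m≤n⇒m<n∨m≡n s<m
  ...   | inj₁ s+1<m rewrite rim-path {j} s<m | rim-path {j} s+1<m = block-walecki j<k s+1<m
  ...   | inj₂ refl rewrite rim-path {j} s<m | rim-wing j | walecki-last j<k =
    trans (cong (λ b → if b then j + suc k else j + suc k ∸ suc k) (dec-false ((j + suc k) <? k) (λ lt → <⇒≱ lt (≤-trans (n≤1+n k) (m≤n+m (suc k) j)))))
          (m+n∸n≡m j (suc k))
  fan-rim j<k t<1+m | end refl  = contradiction t<1+m (<-irrefl refl)
  fan-rim j<k t<1+m | next refl = contradiction t<1+m (<⇒≱ (n<1+n _) ∘ <⇒≤)

  clock-spoke : ∀ {j t} → j < k → t ≤ P → clock (apex j) (rim j t) ≡ j * P + t ∸ 1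
  clock-spoke {j} {t} j<k t≤P with m≤n⇒m<n∨m≡n t≤P
  ... | inj₁ t<P  = trans (clock-apex j (rim-nonapex t<P)) (cong (λ r → j * P + r ∸ 1) (rim-index-rim j<k t≤P))
  ... | inj₂ refl = begin
    clock (apex j) (rim j P)         ≡⟨ cong (clock (apex j)) (rim-apex j) ⟩
    (j ⊓ suc j) * P + suc m          ≡⟨ cong (λ i → i * P + suc m) (m≤n⇒m⊓n≡m (n≤1+n j)) ⟩
    j * P + suc m                    ≡⟨ cong (_∸ 1) (+-suc (j * P) (suc m)) ⟨
    j * P + P ∸ 1                    ∎
    where open ≡-Reasoning

  clock-rim : ∀ {j t} → j < k → t < P → clock (rim j t) (rim j (suc t)) ≡ j * P + t
  clock-rim {j} {t} j<k t<P with m≤n⇒m<n∨m≡n (s≤s⁻¹ t<P)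
  ... | inj₁ t<1+m = begin
    clock (rim j t) (rim j (suc t))                              ≡⟨ clock-nonapex (rim-nonapex t<P) (rim-nonapex (s≤s t<1+m)) ⟩
    fan (rim j t) (rim j (suc t)) * P + (rim-index _ (rim j t) ⊓ rim-index _ (rim j (suc t)))
                                                                   ≡⟨ cong (λ f → f * P + (rim-index f (rim j t) ⊓ rim-index f (rim j (suc t)))) (fan-rim j<k t<1+m) ⟩
    j * P + (rim-index j (rim j t) ⊓ rim-index j (rim j (suc t))) ≡⟨ cong₂ (λ a b → j * P + (a ⊓ b)) (rim-index-rim j<k (<⇒≤ t<P)) (rim-index-rim j<k t<P) ⟩
    j * P + (t ⊓ suc t)                                            ≡⟨ cong (j * P +_) (m≤n⇒m⊓n≡m (n≤1+n t)) ⟩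
    j * P + t                                                      ∎
    where open ≡-Reasoning
  ... | inj₂ refl rewrite rim-wing j | rim-apex j
                        | dec-false (parity j ≟ℙ parity (suc j)) (parity[1+n]≢parity[n] j ∘ sym) = shuffle (k + k) (j * P)
    where
    shuffle : ∀ a c → suc (suc (a + c + 0)) ≡ c + suc (suc a)
    shuffle = solve-∀

  apex≢nonapex : ∀ {j v} → NonApex v → apex j ≢ v
  apex≢nonapex base ()
  apex≢nonapex wing ()

  apex∉rim : ∀ {j t} → t ≤ P → apex j ≢ rim j t
  apex∉rim {j} t≤P with m≤n⇒m<n∨m≡n t≤P
  ... | inj₁ t<P  = apex≢nonapex (rim-nonapex t<P)
  ... | inj₂ refl = λ eq → <-irrefl (apex-injective (trans eq (rim-apex j))) (n<1+n j)
    where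
    apex-injective : ∀ {i i′} → apex i ≡ apex i′ → i ≡ i′
    apex-injective refl = refl

  nonapex<n : ∀ {n v} → NonApex v → Valid v → m + 2 ≤ n → ⌜ v ⌝ < n
  nonapex<n {v = base x}  base x<m    room = ≤-trans x<m (≤-trans (m≤m+n m 2) room)
  nonapex<n {v = wing 0ℙ} wing _      room = ≤-trans (+-monoʳ-< m z<s) room
  nonapex<n {v = wing 1ℙ} wing _      room = ≤-trans (+-monoʳ-< m (s≤s z<s)) room

  module _ {b′ n : ℕ} (b≤k : suc b′ ≤ k) (room : m + suc (suc (suc b′)) ≤ n) where

    walecki-chain : IsFanChain n (suc m) (suc b′) (b′ * P + m) (λ j → ⌜ apex j ⌝) (λ j t → ⌜ rim j t ⌝)
                               (λ u v → clock (kind u) (kind v))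
    walecki-chain = record
      { apex∉rim    = λ {j} {t} _ t≤P → apex∉rim t≤P ∘ ⌜⌝-injective tt (rim-valid j t)
      ; rim-step    = λ {j} {t} j<b t<P eq → <-irrefl (rim-injective (below-k j<b) (<⇒≤ t<P) t<P (⌜⌝-injective (rim-valid j t) (rim-valid j (suc t)) eq)) (n<1+n t)
      ; rim-skip    = λ {j} {t} j<b t+2≤P eq → <-irrefl (rim-injective (below-k j<b) (≤-trans (m≤n+m t 2) t+2≤P) t+2≤P
                                                      (⌜⌝-injective (rim-valid j t) (rim-valid j (2 + t)) eq)) (m<n+m t z<s)
      ; next-apex   = λ {j} _ → cong ⌜_⌝ (rim-apex j)
      ; next-rim    = λ {j} _ → cong ⌜_⌝ (rim-wing j)
      ; junction    = λ {j} _ → apex≢nonapex {j} (rim-nonapex {suc j} {1} (s≤s (s≤s z≤n))) ∘ ⌜⌝-injective tt (rim-valid (suc j) 1)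
      ; bounded     = bounded
      ; clock-sym   = λ u v → clock-sym (kind u) (kind v)
      ; clock-spoke = λ {j} {t} j<b t≤P → trans (cong₂ clock (kind-⌜⌝ (apex j) tt) (kind-⌜⌝ (rim j t) (rim-valid j t)))
                                                 (clock-spoke (below-k j<b) t≤P)
      ; clock-rim   = λ {j} {t} j<b t<P → trans (cong₂ clock (kind-⌜⌝ (rim j t) (rim-valid j t)) (kind-⌜⌝ (rim j (suc t)) (rim-valid j (suc t))))
                                                (clock-rim (below-k j<b) t<P)
      ; length      = ≤-trans (+-monoʳ-< (b′ * P) (≤-trans (n<1+n m) (n≤1+n _))) (≤-reflexive (+-comm (b′ * P) P))
      }
      where
      below-k : ∀ {j} → j < suc b′ → j < k
      below-k j<b = ≤-trans j<b b≤k

      room′ : m + 2 ≤ n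
      room′ = ≤-trans (+-monoʳ-≤ m (s≤s (s≤s z≤n))) room

      apex<n : ∀ {j} → j ≤ b′ → ⌜ apex j ⌝ < n
      apex<n j≤b′ = ≤-trans (+-monoʳ-< m (s≤s (s≤s (s≤s j≤b′)))) room

      bounded : ∀ {j t} → t < P → j * P + t ≤ b′ * P + m → ⌜ apex j ⌝ < n × ⌜ rim j t ⌝ < n × ⌜ rim j (suc t) ⌝ < n
      bounded {j} {t} t<P i≤L with m≤n⇒m<n∨m≡n t<P
      ... | inj₁ t+1<P = apex<n j≤b′ , nonapex<n (rim-nonapex t<P) (rim-valid j t) room′
                                     , nonapex<n (rim-nonapex t+1<P) (rim-valid j (suc t)) room′
        where
        j≤b′ : j ≤ b′
        j≤b′ = s≤s⁻¹ (*-cancelʳ-< P j (suc b′) (≤-<-trans (≤-trans (m≤m+n (j * P) t) i≤L)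
                        (≤-trans (+-monoʳ-< (b′ * P) (≤-trans (n<1+n m) (n≤1+n _))) (≤-reflexive (+-comm (b′ * P) P)))))
      ... | inj₂ refl  = apex<n (<⇒≤ j<b′) , nonapex<n (rim-nonapex t<P) (rim-valid j t) room′
                                           , subst (_< n) (cong ⌜_⌝ (sym (rim-apex j))) (apex<n j<b′)
        where
        j<b′ : j < b′
        j<b′ = ≰⇒> λ b′≤j → <⇒≱ (+-monoʳ-< (b′ * P) (n<1+n m)) (≤-trans (+-monoˡ-≤ (suc m) (*-monoˡ-≤ P b′≤j)) i≤L)

-- Small cases and the theorem

strip : (n : ℕ) .{{_ : NonZero n}} → ℕ → Subset n
strip n i = triangle (i % n) (suc i % n) (suc (suc i) % n)

strip⇒HsAtLeast : ∀ n .{{_ : NonZero n}} L → {True (induced-path? (strip n) L)} → HsAtLeast n 3 L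
strip⇒HsAtLeast n L {ok} = induced-path⇒HsAtLeast (toWitness ok)

walecki⇒HsAtLeast : ∀ {k b′ n} → suc b′ ≤ k → suc (k + k) + suc (suc (suc b′)) ≤ n →
                HsAtLeast n 3 (b′ * (3 + (k + k)) + suc (k + k))
walecki⇒HsAtLeast {k} b≤k room = induced-path⇒HsAtLeast (fan-chain-induced (WaleckiFans.walecki-chain k b≤k room))

LowerBound : ℕ → Set
LowerBound n = Σ ℕ λ m → (2 * ((n ∸ 3) * (n ∸ 3)) ≤ 9 * m) × HsAtLeast n 3 m

-- n = 9 + 3q + r: use 2 + q fans around paths on 5 + 2q base vertices when r ≤ 1, and
-- 2 + q fans around paths on 7 + 2q base vertices when r = 2.
lower-bound-large : ∀ q r → r < 3 → LowerBound (9 + (r + q * 3))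
lower-bound-large q 0 _ = _ , ≤-trans (m≤m+n _ _) (≤-reflexive (sym (gap q))) , walecki⇒HsAtLeast {2 + q} {1 + q} ≤-refl (≤-reflexive (room q))
  where
  room : ∀ q → suc ((2 + q) + (2 + q)) + (4 + q) ≡ 9 + (0 + q * 3)
  room = solve-∀
  gap : ∀ q → 9 * ((1 + q) * (3 + ((2 + q) + (2 + q))) + suc ((2 + q) + (2 + q))) ≡ 2 * ((6 + (0 + q * 3)) * (6 + (0 + q * 3))) + (27 * q + 36)
  gap = solve-∀
lower-bound-large q 1 _ = _ , ≤-trans (m≤m+n _ _) (≤-reflexive (sym (gap q))) , walecki⇒HsAtLeast {2 + q} {1 + q} ≤-refl (≤-trans (≤-reflexive (room q)) (n≤1+n _))
  where
  room : ∀ q → suc ((2 + q) + (2 + q)) + (4 + q) ≡ 9 + (0 + q * 3)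
  room = solve-∀
  gap : ∀ q → 9 * ((1 + q) * (3 + ((2 + q) + (2 + q))) + suc ((2 + q) + (2 + q))) ≡ 2 * ((7 + q * 3) * (7 + q * 3)) + (15 * q + 10)
  gap = solve-∀
lower-bound-large q 2 _ = _ , ≤-trans (m≤m+n _ _) (≤-reflexive (sym (gap q))) , walecki⇒HsAtLeast {3 + q} {1 + q} (n≤1+n _) (≤-reflexive (room q))
  where
  room : ∀ q → suc ((3 + q) + (3 + q)) + (4 + q) ≡ 9 + (2 + q * 3)
  room = solve-∀
  gap : ∀ q → 9 * ((1 + q) * (3 + ((3 + q) + (3 + q))) + suc ((3 + q) + (3 + q))) ≡ 2 * ((8 + q * 3) * (8 + q * 3)) + (21 * q + 16)
  gap = solve-∀
lower-bound-large q (suc (suc (suc _))) (s≤s (s≤s (s≤s ())))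

lower-bound : ∀ n → 3 ≤ n → LowerBound n
lower-bound 0 ()
lower-bound 1 (s≤s ())
lower-bound 2 (s≤s (s≤s ()))
lower-bound 3 _ = 0 , z≤n , strip⇒HsAtLeast 3 0
lower-bound 4 _ = 1 , ≤ᵇ⇒≤ 2 9 _ , strip⇒HsAtLeast 4 1
lower-bound 5 _ = 1 , ≤ᵇ⇒≤ 8 9 _ , strip⇒HsAtLeast 5 1
lower-bound 6 _ = 2 , ≤ᵇ⇒≤ 18 18 _ , strip⇒HsAtLeast 6 2
lower-bound 7 _ = 4 , ≤ᵇ⇒≤ 32 36 _ , strip⇒HsAtLeast 7 4
lower-bound 8 _ = 6 , ≤ᵇ⇒≤ 50 54 _ , strip⇒HsAtLeast 8 6
lower-bound (suc (suc (suc (suc (suc (suc (suc (suc (suc n′))))))))) _ =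
  subst LowerBound (cong (9 +_) (sym (m≡m%n+[m/n]*n n′ 3))) (lower-bound-large (n′ / 3) (n′ % 3) (m%n<n n′ 3))

theorem2p8 : (n : ℕ) → 3 ≤ n →
    (Σ ℕ λ m → (2 * ((n ∸ 3) * (n ∸ 3)) ≤ 9 * m) × HsAtLeast n 3 m)
    × (Σ ℕ λ m → (4 * m ≤ n * n) × HsAtMost n 3 m)
theorem2p8 n 3≤n = lower-bound n 3≤n , (n * n / 4 , ≤-trans (≤-reflexive (*-comm 4 (n * n / 4))) (m/n*n≤m (n * n) 4) , upper-bound n)
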